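{- Let $N=8$. There is no element $p=\sum_i x_iw^i$ with real coefficients $x_i\ge0$ ($w^i$ words) such that $\mathfrak{J}_{(2,2,2,2)}(\mathbf{u})-p$ lies in $\mathbb{R}\otimes I$ simultaneously for every $I\in\{I_{\mathrm{Lam}}^{\mathrm{st},k}:k\in[8]\}\cup\{I_{\mathrm{plac}}^{\mathrm{st}}\}$. Hence there is also no such $p$ with $\mathfrak{J}_{(2,2,2,2)}(\mathbf{u})-p\in\mathbb{R}\otimes I_{\mathrm{Assaf}}^{\mathrm{st},k}$ simultaneously for all $k\in[8]$.
   Context: $\mathcal{U}=\mathbb{Z}\langle u_1,\dots,u_8\rangle$ (letter $a$ = $u_a$), inside $\mathcal{U}_q=\mathbb{Q}(q)\otimes\mathcal{U}$. $e_d(\mathbf{u})=\sum_{8\ge i_1>\cdots>i_d\ge1}u_{i_1}\cdots u_{i_d}$; $\mathfrak{J}_\lambda(\mathbf{u})=\sum_{\pi\in S_t}\mathrm{sgn}(\pi)e_{\lambda'_1+\pi(1)-1}(\mathbf{u})\cdots e_{\lambda'_t+\pi(t)-t}(\mathbf{u})$ ($\lambda'$ conjugate, $t=\lambda_1$); so $\mathfrak{J}_{(2,2,2,2)}(\mathbf{u})=e_4(\mathbf{u})^2-e_5(\mathbf{u})e_3(\mathbf{u})$. $I_{\mathrm{Lam}}^{\mathrm{st},k}=\mathcal{U}\cap J_{\mathrm{Lam}}^{\mathrm{st},k}$, where $J_{\mathrm{Lam}}^{\mathrm{st},k}$ is the two-sided ideal of $\mathcal{U}_q$ generated by $ac-ca$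 for $c-a>k$, $ab-q^{ -1}ba$ for $0<b-a<k$, and all words with a repeated letter. $I_{\mathrm{plac}}^{\mathrm{st}}$ is the two-sided ideal of $\mathcal{U}$ generated by $acb-cab$ and $bac-bca$ for letters $a<b<c$ and all words with a repeated letter. $I_{\mathrm{Assaf}}^{\mathrm{st},k}$ is generated by, for $a<b<c$: $bac-bca$, $acb-cab$ if $c-a>k$; $bac-acb$, $bca-cab$ if $c-a\le k$; and all words with a repeated letter. -}

module Defs where

open import Level using (0ℓ)
open import Data.Nat as ℕ using (ℕ; zero; suc)
open import Data.Integer as ℤ using (ℤ; +_; -[1+_])
open import Data.Fin using (Fin; toℕ)
open import Data.Fin.Properties using () renaming (_≟_ to _≟F_)
open import Data.List using (List; []; _∷_; [_]; _++_; map; concatMap; filter; allFin)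
open import Data.List.Properties using (≡-dec)
open import Data.List.Relation.Unary.All using (All)
open import Data.List.Relation.Unary.Linked using (Linked; linked?)
open import Data.List.Relation.Unary.Unique.Propositional using (Unique)
open import Data.Product using (Σ; _×_; _,_; ∃; ∃-syntax; proj₁)
open import Data.Sum using (_⊎_)
open import Data.Bool using (if_then_else_)
open import Relation.Nullary using (¬_; does)
open import Relation.Binary.PropositionalEquality using (_≡_; _≢_)
open import Algebra.Bundles using (CommutativeRing)

-- Alphabet: the letter a : Fin 8 stands for u_{toℕ a + 1}; letters are
-- compared via toℕ (differences c - a are unaffected by the shift).

Letter : Set
Letter = Fin 8

Word : Set
Word = List Letter

_≟W_ : (v w : Word) → _
_≟W_ = ≡-dec _≟F_

HasRepeat : Word → Set
HasRepeat w = ¬ Unique w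

-- Elements of U = ℤ⟨u_1,…,u_8⟩ as formal finite sums  Σ c · w.

ZPoly : Set
ZPoly = List (ℤ × Word)

coeff : ZPoly → Word → ℤ
coeff []            w = + 0
coeff ((c , v) ∷ f) w = if does (v ≟W w) then c ℤ.+ coeff f w else coeff f w

_⊕_ : ZPoly → ZPoly → ZPoly
f ⊕ g = f ++ g

negP : ZPoly → ZPoly
negP = map (λ { (c , w) → (ℤ.- c , w) })

_⊗_ : ZPoly → ZPoly → ZPoly
f ⊗ g = concatMap (λ { (c , v) → map (λ { (d , u) → (c ℤ.* d , v ++ u) }) g }) f

allWords : ℕ → List Word
allWords zero    = [ [] ]
allWords (suc d) = concatMap (λ a → map (a ∷_) (allWords d)) (allFin 8)

-- e_d(u) = Σ_{8 ≥ i_1 > ⋯ > i_d ≥ 1} u_{i_1} ⋯ u_{i_d}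
elem : ℕ → ZPoly
elem d = map (λ w → (+ 1 , w))
             (filter (linked? (λ x y → toℕ y ℕ.<? toℕ x)) (allWords d))

J2222 : ZPoly
J2222 = (elem 4 ⊗ elem 4) ⊕ negP (elem 5 ⊗ elem 3)

-- Two-sided ideal of U generated by a set of generators (predicate Gen):
-- f ∈ I  iff  f = Σ_j c_j · l_j g_j r_j  with c_j ∈ ℤ, l_j r_j words, Gen g_j.

expand : List (ℤ × Word × ZPoly × Word) → ZPoly
expand = concatMap (λ { (c , l , g , r) → ([ (c , l) ] ⊗ g) ⊗ [ (+ 1 , r) ] })

genTerm : ℤ × Word × ZPoly × Word → ZPoly
genTerm (c , l , g , r) = g

InIdeal : (ZPoly → Set) → ZPoly → Set
InIdeal Gen f = Σ (List (ℤ × Word × ZPoly × Word)) λ comb →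
  All (λ t → Gen (genTerm t)) comb × (∀ w → coeff f w ≡ coeff (expand comb) w)

repGen : ZPoly → Set
repGen g = ∃[ w ] (HasRepeat w × g ≡ [ (+ 1 , w) ])

placGen : ZPoly → Set
placGen g =
  (∃[ a ] ∃[ b ] ∃[ c ] (toℕ a ℕ.< toℕ b × toℕ b ℕ.< toℕ c ×
     (g ≡ (+ 1 , a ∷ c ∷ b ∷ []) ∷ (ℤ.- + 1 , c ∷ a ∷ b ∷ []) ∷ []
      ⊎ g ≡ (+ 1 , b ∷ a ∷ c ∷ []) ∷ (ℤ.- + 1 , b ∷ c ∷ a ∷ []) ∷ [])))
  ⊎ repGen g

I-plac : ZPoly → Set
I-plac = InIdeal placGen

assafGen : ℕ → ZPoly → Set
assafGen k g =
  (∃[ a ] ∃[ b ] ∃[ c ] (toℕ a ℕ.< toℕ b × toℕ b ℕ.< toℕ c ×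
     ((toℕ a ℕ.+ k ℕ.< toℕ c ×
        (g ≡ (+ 1 , b ∷ a ∷ c ∷ []) ∷ (ℤ.- + 1 , b ∷ c ∷ a ∷ []) ∷ []
         ⊎ g ≡ (+ 1 , a ∷ c ∷ b ∷ []) ∷ (ℤ.- + 1 , c ∷ a ∷ b ∷ []) ∷ []))
      ⊎ (toℕ c ℕ.≤ toℕ a ℕ.+ k ×
        (g ≡ (+ 1 , b ∷ a ∷ c ∷ []) ∷ (ℤ.- + 1 , a ∷ c ∷ b ∷ []) ∷ []
         ⊎ g ≡ (+ 1 , b ∷ c ∷ a ∷ []) ∷ (ℤ.- + 1 , c ∷ a ∷ b ∷ []) ∷ [])))))
  ⊎ repGen g

I-Assaf : ℕ → ZPoly → Set
I-Assaf k = InIdeal (assafGen k)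

-- I_Lam^{st,k} = U ∩ J_Lam^{st,k}, J an ideal of U_q = ℚ(q) ⊗ U.
-- Elements of ℤ[q,q⁻¹]⟨u⟩ as formal sums Σ c q^e w  (c ∈ ℤ, e ∈ ℤ).
-- Since ℚ(q) = Frac ℤ[q,q⁻¹], an element f ∈ U lies in J iff there is a
-- nonzero D ∈ ℤ[q,q⁻¹] with D·f = Σ_j c_j q^{e_j} l_j g_j r_j (g_j generators).

LPoly : Set
LPoly = List (ℤ × ℤ × Word)

coeffL : LPoly → ℤ → Word → ℤ
coeffL []                n w = + 0
coeffL ((c , e , v) ∷ f) n w =
  if does (v ≟W w) then (if does (e ℤ.≟ n) then c ℤ.+ coeffL f n w else coeffL f n w)
  else coeffL f n w

_⊗L_ : LPoly → LPoly → LPoly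
f ⊗L g = concatMap (λ { (c , e , v) → map (λ { (d , e′ , u) → (c ℤ.* d , e ℤ.+ e′ , v ++ u) }) g }) f

-- Laurent polynomials in q with integer coefficients: Σ c q^e
LaurentZ : Set
LaurentZ = List (ℤ × ℤ)

coeffLaurent : LaurentZ → ℤ → ℤ
coeffLaurent []            n = + 0
coeffLaurent ((c , e) ∷ f) n = if does (e ℤ.≟ n) then c ℤ.+ coeffLaurent f n else coeffLaurent f n

NonzeroLaurent : LaurentZ → Set
NonzeroLaurent D = ∃[ n ] (coeffLaurent D n ≢ + 0)

scaleL : LaurentZ → ZPoly → LPoly
scaleL D f = concatMap (λ { (d , e) → map (λ { (c , w) → (d ℤ.* c , e , w) }) f }) D

lamGen : ℕ → LPoly → Set
lamGen k g =
  (∃[ a ] ∃[ c ] (toℕ a ℕ.+ k ℕ.< toℕ c ×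
     g ≡ (+ 1 , + 0 , a ∷ c ∷ []) ∷ (ℤ.- + 1 , + 0 , c ∷ a ∷ []) ∷ []))
  ⊎ (∃[ a ] ∃[ b ] (toℕ a ℕ.< toℕ b × toℕ b ℕ.< toℕ a ℕ.+ k ×
     g ≡ (+ 1 , + 0 , a ∷ b ∷ []) ∷ (ℤ.- + 1 , ℤ.- + 1 , b ∷ a ∷ []) ∷ []))
  ⊎ (∃[ w ] (HasRepeat w × g ≡ [ (+ 1 , + 0 , w) ]))

expandL : List (ℤ × ℤ × Word × LPoly × Word) → LPoly
expandL = concatMap (λ { (c , e , l , g , r) → ([ (c , e , l) ] ⊗L g) ⊗L [ (+ 1 , + 0 , r) ] })

genTermL : ℤ × ℤ × Word × LPoly × Word → LPoly
genTermL (c , e , l , g , r) = g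

I-Lam : ℕ → ZPoly → Set
I-Lam k f = Σ LaurentZ λ D → NonzeroLaurent D ×
  Σ (List (ℤ × ℤ × Word × LPoly × Word)) λ comb →
    All (λ t → lamGen k (genTermL t)) comb ×
    (∀ n w → coeffL (scaleL D f) n w ≡ coeffL (expandL comb) n w)

-- Real coefficients.  ℝ is unavailable; we quantify over every commutative
-- ring R with a "nonnegativity" cone (ℝ with x ≥ 0 is an instance).

record NonnegCone (R : CommutativeRing 0ℓ 0ℓ) : Set₁ where
  open CommutativeRing R
  field
    Nonneg     : Carrier → Set
    Nonneg-≈   : ∀ {x y} → x ≈ y → Nonneg x → Nonneg y
    Nonneg-0   : Nonneg 0#
    Nonneg-1   : Nonneg 1#
    Nonneg-+   : ∀ {x y} → Nonneg x → Nonneg y → Nonneg (x + y)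
    Nonneg-*   : ∀ {x y} → Nonneg x → Nonneg y → Nonneg (x * y)
    Nonneg-neg : ¬ Nonneg (- 1#)

module _ (R : CommutativeRing 0ℓ 0ℓ) where
  open CommutativeRing R

  natCast : ℕ → Carrier
  natCast zero    = 0#
  natCast (suc n) = 1# + natCast n

  intCast : ℤ → Carrier
  intCast (+ n)    = natCast n
  intCast -[1+ n ] = - natCast (suc n)

  RPoly : Set
  RPoly = List (Carrier × Word)

  coeffR : RPoly → Word → Carrier
  coeffR []            w = 0#
  coeffR ((x , v) ∷ p) w = if does (v ≟W w) then x + coeffR p w else coeffR p w

  spanCoeff : List (Carrier × ZPoly) → Word → Carrier
  spanCoeff []            w = 0#
  spanCoeff ((r , g) ∷ s) w = r * intCast (coeff g w) + spanCoeff s w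

  -- f - p ∈ R ⊗ I  (I ⊆ U given by a membership predicate)
  DiffInSpan : (ZPoly → Set) → ZPoly → RPoly → Set
  DiffInSpan I f p = Σ (List (Carrier × ZPoly)) λ s →
    All (λ t → I (Data.Product.proj₂ t)) s ×
    (∀ w → intCast (coeff f w) - coeffR p w ≈ spanCoeff s w)

-- Two ℤ-linear functionals on ℤ⟨u⟩, both supported on the permutations of
-- u_1 … u_8, separate 𝔍_{(2,2,2,2)} from the nonnegative cone.
--
-- lamFunctional counts permutations by which of u_1, u_8 comes first and by
-- their number of q-inversions (inversions other than u_8 before u_1), with
-- weights found by computer.  In J_Lam^{st,7} the only relations touching
-- permutations are ab = q⁻¹ba with 0 < b − a < 7, which raise the q-inversions
-- by one while lowering the q-degree by one; weighting q^d w by the count at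
-- N − d q-inversions therefore kills J_Lam^{st,7}, and since ℤ[q^±1] has no
-- zero divisors the functional kills I_Lam^{st,7} = U ∩ J_Lam^{st,7}.  The
-- same counts are invariant under the relations of I_Assaf^{st,7}.
--
-- placticFunctional is the indicator of a set of permutations closed under
-- Knuth moves, so it kills I_plac^st and I_Assaf^{st,1}.
--
-- lamFunctional ≥ placticFunctional on every word, yet the two functionals take
-- the values 11 and 12 on 𝔍.  A p with nonnegative coefficients congruent to 𝔍
-- modulo both ideals would give their difference the value 11 − 12 < 0.

module Submission where

open import Level using (0ℓ)
open import Algebra.Bundles using (CommutativeRing)
open import Data.Bool using (Bool; true; false; if_then_else_; _∧_)
open import Data.Bool.Properties using (T-≡; T-∧)
open import Data.Empty using (⊥; ⊥-elim)
open import Data.Fin as Fin using (Fin; toℕ)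
import Data.Fin.Properties as Fin
open import Data.Integer as ℤ using (ℤ; +_; -[1+_]; +<+)
import Data.Integer.Properties as ℤ
open import Data.Integer.Tactic.RingSolver using (solve-∀)
open import Data.List using (List; []; _∷_; _++_; [_]; map; length; allFin; filter; deduplicate; upTo)
import Data.List.Extrema ℤ.≤-totalOrder as Extrema
import Data.List.Properties as List
open import Data.List.Membership.Propositional using (_∈_; _∉_)
import Data.List.Membership.Propositional.Properties as ∈
open import Data.List.Relation.Binary.Permutation.Propositional using (_↭_; ↭-swap; ↭-prep; ↭-refl; ↭-sym; ↭⇒↭ₛ)
import Data.List.Relation.Binary.Permutation.Propositional.Properties as ↭
import Data.List.Relation.Binary.Permutation.Setoid.Properties as ↭ₛ
open import Data.List.Relation.Unary.All as All using (All; []; _∷_)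
import Data.List.Relation.Unary.All.Properties as All
open import Data.List.Relation.Unary.AllPairs using (AllPairs; []; _∷_)
open import Data.List.Relation.Unary.Any using (here; there)
open import Data.List.Relation.Unary.Unique.Propositional using (Unique)
import Data.List.Relation.Unary.Unique.Propositional.Properties as Unique
import Data.List.Relation.Unary.Unique.DecPropositional.Properties ℤ._≟_ as Dedup
open import Data.List.Relation.Unary.Unique.DecPropositional (Fin._≟_ {8}) using (unique?)
open import Data.Maybe using (Maybe; just; nothing)
import Data.Maybe.Properties as Maybe
open import Data.Nat as ℕ using (ℕ; zero; suc; _<_; _≤_; _<?_; s≤s; z≤n)
import Data.Nat.Properties as ℕ
import Data.Nat.Tactic.RingSolver as ℕ-Solver
open import Data.Product using (Σ; _×_; _,_; proj₁; proj₂; ∃-syntax)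
import Data.Product.Properties as Product
open import Data.Sum using (_⊎_; inj₁; inj₂)
open import Data.Unit using (tt)
open import Function using (_∘_)
open import Function.Bundles using (Equivalence; mk⇔)
open import Relation.Binary.Definitions using (DecidableEquality; tri<; tri≈; tri>)
open import Relation.Binary.PropositionalEquality as ≡ using (_≡_; _≢_)
open import Relation.Nullary using (¬_)
open import Relation.Nullary.Decidable using (Dec; yes; no; does; _×-dec_; _⊎-dec_; ¬?; toWitness; dec-true; dec-false; does-⇔)
open import Relation.Nullary.Negation using (contradiction)
open import Algebra.Properties.AbelianGroup ℤ.+-0-abelianGroup using (∙-cancelʳ)
open import Algebra.Properties.CommutativeSemigroup ℕ.+-commutativeSemigroup using (x∙yz≈y∙xz)
open import Defs
open import Data.List.Membership.DecPropositional _≟W_ using (_∈?_)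
open import Data.List.Membership.DecPropositional ℤ._≟_ using () renaming (_∈?_ to _∈ℤ?_)

module FormalSums (A : CommutativeRing 0ℓ 0ℓ) {K : Set} (_≟K_ : DecidableEquality K) where
  open CommutativeRing A
  open import Algebra.Properties.CommutativeSemigroup +-commutativeSemigroup using (interchange)
  open import Algebra.Properties.Ring ring using (-1*x≈-x)
  open import Relation.Binary.Reasoning.Setoid setoid

  FormalSum : Set
  FormalSum = List (Carrier × K)

  coefficient : FormalSum → K → Carrier
  coefficient []             k = 0#
  coefficient ((x , k′) ∷ f) k = if does (k′ ≟K k) then x + coefficient f k else coefficient f k

  eval : (K → Carrier) → FormalSum → Carrier
  eval φ []            = 0#
  eval φ ((x , k) ∷ f) = x * φ k + eval φ f

  sumOver : List K → (K → Carrier) → Carrier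
  sumOver []      g = 0#
  sumOver (k ∷ L) g = g k + sumOver L g

  SupportedOn : List K → (K → Carrier) → Set
  SupportedOn L φ = ∀ k → k ∈ L ⊎ φ k ≈ 0#

  sumOver-cong : ∀ L {g h} → (∀ k → g k ≈ h k) → sumOver L g ≈ sumOver L h
  sumOver-cong []      g≈h = refl
  sumOver-cong (k ∷ L) g≈h = +-cong (g≈h k) (sumOver-cong L g≈h)

  sumOver-+ : ∀ L g h → sumOver L (λ k → g k + h k) ≈ sumOver L g + sumOver L h
  sumOver-+ []      g h = sym (+-identityˡ 0#)
  sumOver-+ (k ∷ L) g h = trans (+-congˡ (sumOver-+ L g h)) (interchange (g k) (h k) _ _)

  sumOver-*ˡ : ∀ L x g → sumOver L (λ k → x * g k) ≈ x * sumOver L g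
  sumOver-*ˡ []      x g = sym (zeroʳ x)
  sumOver-*ˡ (k ∷ L) x g = trans (+-congˡ (sumOver-*ˡ L x g)) (sym (distribˡ x (g k) _))

  sumOver-zero : ∀ L g → (∀ k → k ∈ L → g k ≈ 0#) → sumOver L g ≈ 0#
  sumOver-zero []      g g≈0 = refl
  sumOver-zero (k ∷ L) g g≈0 =
    trans (+-cong (g≈0 k (here ≡.refl)) (sumOver-zero L g (λ k′ k′∈L → g≈0 k′ (there k′∈L))))
          (+-identityˡ 0#)

  sumOver-single : ∀ L g k₀ → Unique L → k₀ ∈ L → (∀ k → k ∈ L → k ≢ k₀ → g k ≈ 0#) → sumOver L g ≈ g k₀
  sumOver-single (k ∷ L) g k₀ (k∉L ∷ uL) k₀∈ g≈0 with k ≟K k₀ | k₀∈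
  ... | yes ≡.refl | _ =
    trans (+-congˡ (sumOver-zero L g (λ k′ k′∈L → g≈0 k′ (there k′∈L) (distinct k∉L k′∈L))))
          (+-identityʳ _)
    where
    distinct : ∀ {L k′} → All (k ≢_) L → k′ ∈ L → k′ ≢ k
    distinct (k≢ ∷ _)  (here ≡.refl) ≡.refl = k≢ ≡.refl
    distinct (_ ∷ k≢s) (there k′∈L)  eq     = distinct k≢s k′∈L eq
  ... | no k≢k₀ | here k₀≡k   = ⊥-elim (k≢k₀ (≡.sym k₀≡k))
  ... | no k≢k₀ | there k₀∈L =
    trans (+-cong (g≈0 k (here ≡.refl) k≢k₀) (sumOver-single L g k₀ uL k₀∈L (λ k′ k′∈L → g≈0 k′ (there k′∈L))))
          (+-identityˡ _)

  monomial : K → Carrier → K → Carrier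
  monomial k₀ x k = if does (k₀ ≟K k) then x else 0#

  term≈sumOver-monomial : ∀ L (φ : K → Carrier) → Unique L → ∀ x k₀ → k₀ ∈ L ⊎ φ k₀ ≈ 0# →
                    x * φ k₀ ≈ sumOver L (λ k → monomial k₀ x k * φ k)
  term≈sumOver-monomial L φ uL x k₀ (inj₁ k₀∈L) = sym (begin
    sumOver L (λ k → monomial k₀ x k * φ k) ≈⟨ sumOver-single L _ k₀ uL k₀∈L off-k₀ ⟩
    monomial k₀ x k₀ * φ k₀                ≈⟨ *-congʳ at-k₀ ⟩
    x * φ k₀                               ∎)
    where
    at-k₀ : monomial k₀ x k₀ ≈ x
    at-k₀ with k₀ ≟K k₀
    ... | yes _   = refl
    ... | no k₀≢k₀ = ⊥-elim (k₀≢k₀ ≡.refl)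
    off-k₀ : ∀ k → k ∈ L → k ≢ k₀ → monomial k₀ x k * φ k ≈ 0#
    off-k₀ k _ k≢k₀ with k₀ ≟K k
    ... | yes k₀≡k = ⊥-elim (k≢k₀ (≡.sym k₀≡k))
    ... | no _     = zeroˡ (φ k)
  term≈sumOver-monomial L φ uL x k₀ (inj₂ φk₀≈0) =
    trans (trans (*-congˡ φk₀≈0) (zeroʳ x)) (sym (sumOver-zero L _ (λ k _ → vanishes k)))
    where
    vanishes : ∀ k → monomial k₀ x k * φ k ≈ 0#
    vanishes k with k₀ ≟K k
    ... | yes ≡.refl = trans (*-congˡ φk₀≈0) (zeroʳ x)
    ... | no _       = zeroˡ (φ k)

  coefficient-∷ : ∀ x k₀ f k → coefficient ((x , k₀) ∷ f) k ≈ monomial k₀ x k + coefficient f k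
  coefficient-∷ x k₀ f k with does (k₀ ≟K k)
  ... | true  = refl
  ... | false = sym (+-identityˡ _)

  eval≈sumOver-coefficient : ∀ L (φ : K → Carrier) → Unique L → (f : FormalSum) →
                             All (λ t → proj₂ t ∈ L ⊎ φ (proj₂ t) ≈ 0#) f →
                             eval φ f ≈ sumOver L (λ k → coefficient f k * φ k)
  eval≈sumOver-coefficient L φ uL [] [] = sym (sumOver-zero L _ (λ k _ → zeroˡ (φ k)))
  eval≈sumOver-coefficient L φ uL ((x , k₀) ∷ f) (k₀-ok ∷ f-ok) = begin
    x * φ k₀ + eval φ f
      ≈⟨ +-cong (term≈sumOver-monomial L φ uL x k₀ k₀-ok) (eval≈sumOver-coefficient L φ uL f f-ok) ⟩
    sumOver L (λ k → monomial k₀ x k * φ k) + sumOver L (λ k → coefficient f k * φ k)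
      ≈⟨ sym (sumOver-+ L _ _) ⟩
    sumOver L (λ k → monomial k₀ x k * φ k + coefficient f k * φ k)
      ≈⟨ sumOver-cong L (λ k → trans (sym (distribʳ (φ k) _ _)) (*-congʳ (sym (coefficient-∷ x k₀ f k)))) ⟩
    sumOver L (λ k → coefficient ((x , k₀) ∷ f) k * φ k) ∎

  supported-terms : ∀ {L φ} → SupportedOn L φ → (f : FormalSum) → All (λ t → proj₂ t ∈ L ⊎ φ (proj₂ t) ≈ 0#) f
  supported-terms supp []            = []
  supported-terms supp ((x , k) ∷ f) = supp k ∷ supported-terms supp f

  eval-resp-coefficient : ∀ {L φ} → Unique L → SupportedOn L φ → ∀ f h →
                          (∀ k → coefficient f k ≈ coefficient h k) → eval φ f ≈ eval φ h
  eval-resp-coefficient {L} {φ} uL supp f h f≈h = begin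
    eval φ f                                    ≈⟨ eval≈sumOver-coefficient L φ uL f (supported-terms supp f) ⟩
    sumOver L (λ k → coefficient f k * φ k)     ≈⟨ sumOver-cong L (λ k → *-congʳ (f≈h k)) ⟩
    sumOver L (λ k → coefficient h k * φ k)     ≈⟨ sym (eval≈sumOver-coefficient L φ uL h (supported-terms supp h)) ⟩
    eval φ h                                    ∎

  eval-++ : ∀ φ f g → eval φ (f ++ g) ≈ eval φ f + eval φ g
  eval-++ φ []            g = sym (+-identityˡ _)
  eval-++ φ ((x , k) ∷ f) g = trans (+-congˡ (eval-++ φ f g)) (sym (+-assoc _ _ _))

  eval-+ : ∀ φ ψ f → eval (λ k → φ k + ψ k) f ≈ eval φ f + eval ψ f
  eval-+ φ ψ []            = sym (+-identityˡ 0#)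
  eval-+ φ ψ ((x , k) ∷ f) =
    trans (+-cong (distribˡ x (φ k) (ψ k)) (eval-+ φ ψ f)) (interchange _ _ _ _)

  eval-cong : ∀ {φ ψ} f → (∀ k → φ k ≈ ψ k) → eval φ f ≈ eval ψ f
  eval-cong []            φ≈ψ = refl
  eval-cong ((x , k) ∷ f) φ≈ψ = +-cong (*-congˡ (φ≈ψ k)) (eval-cong f φ≈ψ)

  eval-binomial : ∀ φ k k′ → φ k ≈ φ k′ → eval φ ((1# , k) ∷ (- 1# , k′) ∷ []) ≈ 0#
  eval-binomial φ k k′ φk≈φk′ = begin
    1# * φ k + (- 1# * φ k′ + 0#) ≈⟨ +-cong (*-identityˡ (φ k)) (+-identityʳ _) ⟩
    φ k + - 1# * φ k′             ≈⟨ +-congˡ (-1*x≈-x (φ k′)) ⟩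
    φ k - φ k′                    ≈⟨ +-congˡ (-‿cong (sym φk≈φk′)) ⟩
    φ k - φ k                     ≈⟨ -‿inverseʳ (φ k) ⟩
    0#                            ∎

  eval-monomial : ∀ φ k → φ k ≈ 0# → eval φ ((1# , k) ∷ []) ≈ 0#
  eval-monomial φ k φk≈0 = trans (+-identityʳ _) (trans (*-congˡ φk≈0) (zeroʳ 1#))

  eval-zero : ∀ {φ} f → (∀ k → φ k ≈ 0#) → eval φ f ≈ 0#
  eval-zero []            φ≈0 = refl
  eval-zero ((x , k) ∷ f) φ≈0 = trans (+-cong (trans (*-congˡ (φ≈0 k)) (zeroʳ x)) (eval-zero f φ≈0)) (+-identityʳ 0#)

module IntegerCast (R : CommutativeRing 0ℓ 0ℓ) where
  open CommutativeRing R
  open import Algebra.Properties.Ring ring using (-0#≈0#; -‿+-comm; -‿involutive; -‿distribˡ-*; -‿distribʳ-*)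
  open import Algebra.Properties.Monoid.Mult +-monoid using (×-homo-+) renaming (_×_ to _×′_)
  open import Algebra.Properties.Semiring.Mult semiring using (×1-homo-*)
  open import Algebra.Properties.CommutativeSemigroup +-commutativeSemigroup using (interchange)
  open import Relation.Binary.Reasoning.Setoid setoid

  natCast≡×1 : ∀ n → natCast R n ≡ n ×′ 1#
  natCast≡×1 zero    = ≡.refl
  natCast≡×1 (suc n) = ≡.cong (λ x → 1# + x) (natCast≡×1 n)

  natCast-+ : ∀ m n → natCast R (m ℕ.+ n) ≈ natCast R m + natCast R n
  natCast-+ m n rewrite natCast≡×1 (m ℕ.+ n) | natCast≡×1 m | natCast≡×1 n = ×-homo-+ 1# m n

  natCast-* : ∀ m n → natCast R (m ℕ.* n) ≈ natCast R m * natCast R n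
  natCast-* m n rewrite natCast≡×1 (m ℕ.* n) | natCast≡×1 m | natCast≡×1 n = ×1-homo-* m n

  intCast-neg : ∀ i → intCast R (ℤ.- i) ≈ - intCast R i
  intCast-neg (+ zero)  = sym -0#≈0#
  intCast-neg (+ suc n) = refl
  intCast-neg -[1+ n ]  = sym (-‿involutive _)

  intCast-⊖ : ∀ m n → intCast R (m ℤ.⊖ n) ≈ natCast R m - natCast R n
  intCast-⊖ m       zero    = sym (trans (+-congˡ -0#≈0#) (+-identityʳ _))
  intCast-⊖ zero    (suc n) = sym (+-identityˡ _)
  intCast-⊖ (suc m) (suc n) = begin
    intCast R (suc m ℤ.⊖ suc n)                 ≡⟨ ≡.cong (intCast R) (ℤ.[1+m]⊖[1+n]≡m⊖n m n) ⟩
    intCast R (m ℤ.⊖ n)                         ≈⟨ intCast-⊖ m n ⟩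
    natCast R m - natCast R n                   ≈⟨ sym (+-identityˡ _) ⟩
    0# + (natCast R m - natCast R n)            ≈⟨ +-congʳ (sym (-‿inverseʳ 1#)) ⟩
    (1# - 1#) + (natCast R m - natCast R n)     ≈⟨ interchange 1# (- 1#) _ _ ⟩
    (1# + natCast R m) + (- 1# - natCast R n)   ≈⟨ +-congˡ (-‿+-comm 1# _) ⟩
    natCast R (suc m) - natCast R (suc n)       ∎

  intCast-+ : ∀ i j → intCast R (i ℤ.+ j) ≈ intCast R i + intCast R j
  intCast-+ (+ m)    (+ n)    = natCast-+ m n
  intCast-+ (+ m)    -[1+ n ] = intCast-⊖ m (suc n)
  intCast-+ -[1+ m ] (+ n)    = trans (intCast-⊖ n (suc m)) (+-comm _ _)
  intCast-+ -[1+ m ] -[1+ n ] = begin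
    - natCast R (suc (suc (m ℕ.+ n)))               ≈⟨ -‿cong (+-congˡ (natCast-+ (suc m) n)) ⟩
    - (1# + (natCast R (suc m) + natCast R n))      ≈⟨ -‿cong (sym (+-assoc _ _ _)) ⟩
    - ((1# + natCast R (suc m)) + natCast R n)      ≈⟨ -‿cong (+-congʳ (+-comm _ _)) ⟩
    - ((natCast R (suc m) + 1#) + natCast R n)      ≈⟨ -‿cong (+-assoc _ _ _) ⟩
    - (natCast R (suc m) + natCast R (suc n))       ≈⟨ sym (-‿+-comm _ _) ⟩
    - natCast R (suc m) - natCast R (suc n)         ∎

  intCast-*-nonneg : ∀ m n → intCast R (+ m ℤ.* + n) ≈ natCast R m * natCast R n
  intCast-*-nonneg m n = trans (reflexive (≡.cong (intCast R) (≡.sym (ℤ.pos-* m n)))) (natCast-* m n)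

  intCast-* : ∀ i j → intCast R (i ℤ.* j) ≈ intCast R i * intCast R j
  intCast-* (+ m)    (+ n)    = intCast-*-nonneg m n
  intCast-* (+ m)    -[1+ n ] = begin
    intCast R (+ m ℤ.* ℤ.- + suc n)        ≡⟨ ≡.cong (intCast R) (≡.sym (ℤ.neg-distribʳ-* (+ m) (+ suc n))) ⟩
    intCast R (ℤ.- (+ m ℤ.* + suc n))      ≈⟨ intCast-neg (+ m ℤ.* + suc n) ⟩
    - intCast R (+ m ℤ.* + suc n)          ≈⟨ -‿cong (intCast-*-nonneg m (suc n)) ⟩
    - (natCast R m * natCast R (suc n))    ≈⟨ -‿distribʳ-* _ _ ⟩
    natCast R m * - natCast R (suc n)      ∎
  intCast-* -[1+ m ] (+ n)    = begin
    intCast R (ℤ.- + suc m ℤ.* + n)        ≡⟨ ≡.cong (intCast R) (≡.sym (ℤ.neg-distribˡ-* (+ suc m) (+ n))) ⟩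
    intCast R (ℤ.- (+ suc m ℤ.* + n))      ≈⟨ intCast-neg (+ suc m ℤ.* + n) ⟩
    - intCast R (+ suc m ℤ.* + n)          ≈⟨ -‿cong (intCast-*-nonneg (suc m) n) ⟩
    - (natCast R (suc m) * natCast R n)    ≈⟨ -‿distribˡ-* _ _ ⟩
    - natCast R (suc m) * natCast R n      ∎
  intCast-* -[1+ m ] -[1+ n ] = begin
    intCast R (+ suc m ℤ.* + suc n)              ≈⟨ intCast-*-nonneg (suc m) (suc n) ⟩
    natCast R (suc m) * natCast R (suc n)        ≈⟨ sym (-‿involutive _) ⟩
    - - (natCast R (suc m) * natCast R (suc n))  ≈⟨ -‿cong (-‿distribʳ-* _ _) ⟩
    - (natCast R (suc m) * - natCast R (suc n))  ≈⟨ -‿distribˡ-* _ _ ⟩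
    - natCast R (suc m) * - natCast R (suc n)    ∎

-- Permutation words

isPermutation : Word → Bool
isPermutation w = does (unique? w) ∧ (length w ℕ.≡ᵇ 8)

isPermutation⇒length≡8 : ∀ w → isPermutation w ≡ true → length w ≡ 8
isPermutation⇒length≡8 w isPerm =
  ℕ.≡ᵇ⇒≡ (length w) 8 (proj₂ (Equivalence.to T-∧ (Equivalence.from T-≡ isPerm)))

Unique-resp-↭ : ∀ {A : Set} {xs ys : List A} → xs ↭ ys → Unique xs → Unique ys
Unique-resp-↭ {A} xs↭ys = ↭ₛ.Unique-resp-↭ (≡.setoid A) (↭⇒↭ₛ xs↭ys)

isPermutation-resp-↭ : ∀ {v w} → v ↭ w → isPermutation v ≡ isPermutation w
isPermutation-resp-↭ {v} {w} v↭w with unique? v | unique? w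
... | yes _   | yes _   = ≡.cong (ℕ._≡ᵇ 8) (↭.↭-length v↭w)
... | no _    | no _    = ≡.refl
... | yes uv  | no ¬uw  = ⊥-elim (¬uw (Unique-resp-↭ v↭w uv))
... | no ¬uv  | yes uw  = ⊥-elim (¬uv (Unique-resp-↭ (↭-sym v↭w) uw))

swap-↭ : ∀ {A : Set} (l : List A) x y r → l ++ x ∷ y ∷ r ↭ l ++ y ∷ x ∷ r
swap-↭ l x y r = ↭.++⁺ˡ l (↭-swap x y ↭-refl)

Unique-infix : ∀ {A : Set} (l u r : List A) → Unique (l ++ u ++ r) → Unique u
Unique-infix []      []      r _            = []
Unique-infix []      (x ∷ u) r (x∉ ∷ uniq) = All.++⁻ˡ u x∉ ∷ Unique-infix [] u r uniq
Unique-infix (x ∷ l) u       r (_ ∷ uniq)  = Unique-infix l u r uniq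

isPermutation-infix : ∀ l u r → ¬ Unique u → isPermutation (l ++ u ++ r) ≡ false
isPermutation-infix l u r ¬uu with unique? (l ++ u ++ r)
... | yes uniq = ⊥-elim (¬uu (Unique-infix l u r uniq))
... | no _     = ≡.refl

toℕ≤7 : ∀ (x : Letter) → toℕ x ≤ 7
toℕ≤7 x = ℕ.≤-pred (Fin.toℕ<n x)

letters-within-7 : ∀ (a c : Letter) → ¬ toℕ a ℕ.+ 7 < toℕ c
letters-within-7 a c a+7<c = ℕ.<⇒≱ a+7<c (ℕ.≤-trans (toℕ≤7 c) (ℕ.m≤n+m 7 (toℕ a)))

allWords-complete : ∀ d (w : Word) → length w ≡ d → w ∈ allWords d
allWords-complete zero    []      ≡.refl = here ≡.refl
allWords-complete (suc d) (a ∷ w) |w|≡ =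
  ∈.∈-concat⁺′ (∈.∈-map⁺ (a ∷_) (allWords-complete d w (ℕ.suc-injective |w|≡)))
               (∈.∈-map⁺ (λ a → map (a ∷_) (allWords d)) (∈.∈-allFin a))

allWords-unique : ∀ d → Unique (allWords d)
allWords-unique zero    = [] ∷ []
allWords-unique (suc d) = Unique.concat⁺ (blocks-unique (allFin 8)) (blocks-disjoint (allFin 8) (Unique.allFin⁺ 8))
  where
  block : Letter → List Word
  block a = map (a ∷_) (allWords d)
  blocks-unique : ∀ (as : List Letter) → All Unique (map block as)
  blocks-unique []       = []
  blocks-unique (a ∷ as) = Unique.map⁺ List.∷-injectiveʳ (allWords-unique d) ∷ blocks-unique as
  same-head : ∀ {a b} {w : Word} → w ∈ block a → w ∈ block b → a ≡ b
  same-head w∈a w∈b with ∈.∈-map⁻ _ w∈a | ∈.∈-map⁻ _ w∈b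
  ... | _ , _ , ≡.refl | _ , _ , eq = List.∷-injectiveˡ eq
  blocks-disjoint : ∀ (as : List Letter) → Unique as →
                    AllPairs (λ u v → ∀ {w} → w ∈ u × w ∈ v → ⊥) (map block as)
  blocks-disjoint []       _            = []
  blocks-disjoint (a ∷ as) (a∉ ∷ uniq) = disjoint-from as a∉ ∷ blocks-disjoint as uniq
    where
    disjoint-from : ∀ bs → All (a ≢_) bs → All (λ v → ∀ {w} → w ∈ block a × w ∈ v → ⊥) (map block bs)
    disjoint-from []       []         = []
    disjoint-from (b ∷ bs) (a≢b ∷ ns) = (λ (w∈a , w∈b) → a≢b (same-head w∈a w∈b)) ∷ disjoint-from bs ns

-- kept abstract so that the 8⁸ words are never unfolded during type checking
abstract
  words8 : List Word
  words8 = allWords 8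

  words8-complete : ∀ w → length w ≡ 8 → w ∈ words8
  words8-complete = allWords-complete 8

  words8-unique : Unique words8
  words8-unique = allWords-unique 8

-- Functionals on ℤ⟨u⟩ killing an ideal

module ℤ⟨u⟩ = FormalSums ℤ.+-*-commutativeRing _≟W_
open ℤ⟨u⟩ using (eval)

coefficient≡coeff : ∀ f w → ℤ⟨u⟩.coefficient f w ≡ coeff f w
coefficient≡coeff []            w = ≡.refl
coefficient≡coeff ((c , v) ∷ f) w rewrite coefficient≡coeff f w = ≡.refl

eval-⊗ˡ : ∀ φ c l g → eval φ ([ (c , l) ] ⊗ g) ≡ c ℤ.* eval (λ w → φ (l ++ w)) g
eval-⊗ˡ φ c l []            = ≡.sym (ℤ.*-zeroʳ c)
eval-⊗ˡ φ c l ((d , u) ∷ g) = begin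
  c ℤ.* d ℤ.* φ (l ++ u) ℤ.+ eval φ ([ (c , l) ] ⊗ g)          ≡⟨ ≡.cong₂ ℤ._+_ (ℤ.*-assoc c d _) (eval-⊗ˡ φ c l g) ⟩
  c ℤ.* (d ℤ.* φ (l ++ u)) ℤ.+ c ℤ.* eval (λ w → φ (l ++ w)) g ≡⟨ ℤ.*-distribˡ-+ c _ _ ⟨
  c ℤ.* eval (λ w → φ (l ++ w)) ((d , u) ∷ g)                   ∎
  where open ≡.≡-Reasoning

eval-⊗ʳ : ∀ φ h r → eval φ (h ⊗ [ (+ 1 , r) ]) ≡ eval (λ w → φ (w ++ r)) h
eval-⊗ʳ φ []            r = ≡.refl
eval-⊗ʳ φ ((c , v) ∷ h) r =
  ≡.cong₂ ℤ._+_ (≡.cong (ℤ._* φ (v ++ r)) (ℤ.*-identityʳ c)) (eval-⊗ʳ φ h r)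

eval-translate : ∀ φ c l g r → eval φ (([ (c , l) ] ⊗ g) ⊗ [ (+ 1 , r) ]) ≡ c ℤ.* eval (λ w → φ (l ++ w ++ r)) g
eval-translate φ c l g r = begin
  eval φ (([ (c , l) ] ⊗ g) ⊗ [ (+ 1 , r) ])  ≡⟨ eval-⊗ʳ φ ([ (c , l) ] ⊗ g) r ⟩
  eval (λ w → φ (w ++ r)) ([ (c , l) ] ⊗ g)   ≡⟨ eval-⊗ˡ (λ w → φ (w ++ r)) c l g ⟩
  c ℤ.* eval (λ w → φ ((l ++ w) ++ r)) g
    ≡⟨ ≡.cong (c ℤ.*_) (ℤ⟨u⟩.eval-cong g (λ w → ≡.cong φ (List.++-assoc l w r))) ⟩
  c ℤ.* eval (λ w → φ (l ++ w ++ r)) g        ∎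
  where open ≡.≡-Reasoning

KillsIdeal : (ZPoly → Set) → (Word → ℤ) → Set
KillsIdeal Gen φ = ∀ l g r → Gen g → eval (λ w → φ (l ++ w ++ r)) g ≡ + 0

eval-ideal : ∀ {Gen φ L} → Unique L → ℤ⟨u⟩.SupportedOn L φ → KillsIdeal Gen φ → ∀ f → InIdeal Gen f → eval φ f ≡ + 0
eval-ideal {Gen} {φ} uL supp kills f (comb , gens , f≡) =
  ≡.trans (ℤ⟨u⟩.eval-resp-coefficient uL supp f (expand comb)
             (λ w → ≡.trans (coefficient≡coeff f w) (≡.trans (f≡ w) (≡.sym (coefficient≡coeff (expand comb) w)))))
          (eval-expand comb gens)
  where
  eval-expand : ∀ comb → All (λ t → Gen (genTerm t)) comb → eval φ (expand comb) ≡ + 0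
  eval-expand []                       []           = ≡.refl
  eval-expand ((c , l , g , r) ∷ comb) (gen ∷ gens) = begin
    eval φ (term ++ expand comb)                   ≡⟨ ℤ⟨u⟩.eval-++ φ term (expand comb) ⟩
    eval φ term ℤ.+ eval φ (expand comb)           ≡⟨ ≡.cong₂ ℤ._+_ (eval-translate φ c l g r) (eval-expand comb gens) ⟩
    c ℤ.* eval (λ w → φ (l ++ w ++ r)) g ℤ.+ + 0  ≡⟨ ≡.cong (λ x → c ℤ.* x ℤ.+ + 0) (kills l g r gen) ⟩
    c ℤ.* + 0 ℤ.+ + 0                             ≡⟨ ≡.trans (ℤ.+-identityʳ _) (ℤ.*-zeroʳ c) ⟩
    + 0                                           ∎
    where
    open ≡.≡-Reasoning
    term : ZPoly
    term = ([ (c , l) ] ⊗ g) ⊗ [ (+ 1 , r) ]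

iverson : Bool → ℤ
iverson b = if b then + 1 else + 0

iverson-nonzero : ∀ b → iverson b ≢ + 0 → b ≡ true
iverson-nonzero true  _  = ≡.refl
iverson-nonzero false nz = contradiction ≡.refl nz

VanishesOnRepeats : (Word → ℤ) → Set
VanishesOnRepeats φ = ∀ l u r → ¬ Unique u → φ (l ++ u ++ r) ≡ + 0

KnuthInvariant : (Word → ℤ) → Set
KnuthInvariant φ = ∀ l r (a b c : Letter) → toℕ a < toℕ b → toℕ b < toℕ c →
  φ (l ++ a ∷ c ∷ b ∷ r) ≡ φ (l ++ c ∷ a ∷ b ∷ r) × φ (l ++ b ∷ a ∷ c ∷ r) ≡ φ (l ++ b ∷ c ∷ a ∷ r)

AssafInvariant : (Word → ℤ) → Set
AssafInvariant φ = ∀ l r (a b c : Letter) → toℕ a < toℕ b → toℕ b < toℕ c →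
  φ (l ++ b ∷ a ∷ c ∷ r) ≡ φ (l ++ a ∷ c ∷ b ∷ r) × φ (l ++ b ∷ c ∷ a ∷ r) ≡ φ (l ++ c ∷ a ∷ b ∷ r)

kills-repeats : ∀ {φ} → VanishesOnRepeats φ → ∀ l g r → repGen g → eval (λ w → φ (l ++ w ++ r)) g ≡ + 0
kills-repeats {φ} rep l g r (w , w-rep , ≡.refl) = ℤ⟨u⟩.eval-monomial (λ w → φ (l ++ w ++ r)) w (rep l w r w-rep)

kills-plactic : ∀ {φ} → KnuthInvariant φ → VanishesOnRepeats φ → KillsIdeal placGen φ
kills-plactic {φ} inv rep l g r (inj₁ (a , b , c , a<b , b<c , inj₁ ≡.refl)) =
  ℤ⟨u⟩.eval-binomial (λ w → φ (l ++ w ++ r)) _ _ (proj₁ (inv l r a b c a<b b<c))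
kills-plactic {φ} inv rep l g r (inj₁ (a , b , c , a<b , b<c , inj₂ ≡.refl)) =
  ℤ⟨u⟩.eval-binomial (λ w → φ (l ++ w ++ r)) _ _ (proj₂ (inv l r a b c a<b b<c))
kills-plactic {φ} inv rep l g r (inj₂ g-rep) = kills-repeats {φ} rep l g r g-rep

-- for k = 1 the condition c ≤ a + 1 never holds, so I_Assaf^{st,1} has the plactic generators
kills-assaf₁ : ∀ {φ} → KnuthInvariant φ → VanishesOnRepeats φ → KillsIdeal (assafGen 1) φ
kills-assaf₁ {φ} inv rep l g r (inj₁ (a , b , c , a<b , b<c , inj₁ (_ , inj₁ ≡.refl))) =
  ℤ⟨u⟩.eval-binomial (λ w → φ (l ++ w ++ r)) _ _ (proj₂ (inv l r a b c a<b b<c))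
kills-assaf₁ {φ} inv rep l g r (inj₁ (a , b , c , a<b , b<c , inj₁ (_ , inj₂ ≡.refl))) =
  ℤ⟨u⟩.eval-binomial (λ w → φ (l ++ w ++ r)) _ _ (proj₁ (inv l r a b c a<b b<c))
kills-assaf₁ inv rep l g r (inj₁ (a , b , c , a<b , b<c , inj₂ (c≤a+1 , _))) =
  ⊥-elim (ℕ.<⇒≱ (ℕ.<-≤-trans (ℕ.s≤s a<b) b<c) (≡.subst (toℕ c ≤_) (ℕ.+-comm (toℕ a) 1) c≤a+1))
kills-assaf₁ {φ} inv rep l g r (inj₂ g-rep) = kills-repeats {φ} rep l g r g-rep

-- on eight letters c − a ≤ 7 always holds, so I_Assaf^{st,7} has only the Assaf generators
kills-assaf₇ : ∀ {φ} → AssafInvariant φ → VanishesOnRepeats φ → KillsIdeal (assafGen 7) φ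
kills-assaf₇ inv rep l g r (inj₁ (a , b , c , a<b , b<c , inj₁ (a+7<c , _))) = ⊥-elim (letters-within-7 a c a+7<c)
kills-assaf₇ {φ} inv rep l g r (inj₁ (a , b , c , a<b , b<c , inj₂ (_ , inj₁ ≡.refl))) =
  ℤ⟨u⟩.eval-binomial (λ w → φ (l ++ w ++ r)) _ _ (proj₁ (inv l r a b c a<b b<c))
kills-assaf₇ {φ} inv rep l g r (inj₁ (a , b , c , a<b , b<c , inj₂ (_ , inj₂ ≡.refl))) =
  ℤ⟨u⟩.eval-binomial (λ w → φ (l ++ w ++ r)) _ _ (proj₂ (inv l r a b c a<b b<c))
kills-assaf₇ {φ} inv rep l g r (inj₂ g-rep) = kills-repeats {φ} rep l g r g-rep

PermutationSupported : (Word → ℤ) → Set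
PermutationSupported φ = ∀ w → isPermutation w ≡ false → φ w ≡ + 0

PermutationSupported⇒SupportedOn : ∀ {φ} → PermutationSupported φ → ℤ⟨u⟩.SupportedOn words8 φ
PermutationSupported⇒SupportedOn {φ} supp w with isPermutation w in isPerm
... | true  = inj₁ (words8-complete w (isPermutation⇒length≡8 w isPerm))
... | false = inj₂ (supp w isPerm)

PermutationSupported⇒VanishesOnRepeats : ∀ {φ} → PermutationSupported φ → VanishesOnRepeats φ
PermutationSupported⇒VanishesOnRepeats supp l u r ¬uu = supp (l ++ u ++ r) (isPermutation-infix l u r ¬uu)

-- A Knuth-closed set of permutations

Between : Letter → Letter → Letter → Set
Between m p q = (toℕ p < toℕ m × toℕ m < toℕ q) ⊎ (toℕ q < toℕ m × toℕ m < toℕ p)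

between? : ∀ m p q → Dec (Between m p q)
between? m p q = ((toℕ p <? toℕ m) ×-dec (toℕ m <? toℕ q)) ⊎-dec ((toℕ q <? toℕ m) ×-dec (toℕ m <? toℕ p))

-- the elementary Knuth transformations xzy ↔ zxy and yxz ↔ yzx (x < y < z) of a three-letter word
knuthMoves : Word → List Word
knuthMoves (x ∷ y ∷ z ∷ []) =
  (if does (between? z x y) then [ y ∷ x ∷ z ∷ [] ] else []) ++ (if does (between? x y z) then [ x ∷ z ∷ y ∷ [] ] else [])
knuthMoves _ = []

movesAtFront : Word → List Word
movesAtFront (x ∷ y ∷ z ∷ r) = map (_++ r) (knuthMoves (x ∷ y ∷ z ∷ []))
movesAtFront _               = []

knuthNeighbours : Word → List Word
knuthNeighbours []      = []
knuthNeighbours (x ∷ w) = movesAtFront (x ∷ w) ++ map (x ∷_) (knuthNeighbours w)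

knuthNeighbours-complete : ∀ l r (a b c : Letter) {v} → v ∈ knuthMoves (a ∷ b ∷ c ∷ []) →
                           l ++ v ++ r ∈ knuthNeighbours (l ++ a ∷ b ∷ c ∷ r)
knuthNeighbours-complete []      r a b c v∈ = ∈.∈-++⁺ˡ (∈.∈-map⁺ (_++ r) v∈)
knuthNeighbours-complete (x ∷ l) r a b c v∈ =
  ∈.∈-++⁺ʳ (movesAtFront (x ∷ l ++ a ∷ b ∷ c ∷ r)) (∈.∈-map⁺ (x ∷_) (knuthNeighbours-complete l r a b c v∈))

module _ (a b c : Letter) (a<b : toℕ a < toℕ b) (b<c : toℕ b < toℕ c) where

  acb→cab : (c ∷ a ∷ b ∷ []) ∈ knuthMoves (a ∷ c ∷ b ∷ [])
  acb→cab rewrite dec-true (between? b a c) (inj₁ (a<b , b<c)) = here ≡.refl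

  cab→acb : (a ∷ c ∷ b ∷ []) ∈ knuthMoves (c ∷ a ∷ b ∷ [])
  cab→acb rewrite dec-true (between? b c a) (inj₂ (a<b , b<c)) = here ≡.refl

  bac→bca : (b ∷ c ∷ a ∷ []) ∈ knuthMoves (b ∷ a ∷ c ∷ [])
  bac→bca rewrite dec-true (between? b a c) (inj₁ (a<b , b<c)) = ∈.∈-++⁺ʳ _ (here ≡.refl)

  bca→bac : (b ∷ a ∷ c ∷ []) ∈ knuthMoves (b ∷ c ∷ a ∷ [])
  bca→bac rewrite dec-true (between? b c a) (inj₂ (a<b , b<c)) = ∈.∈-++⁺ʳ _ (here ≡.refl)

u₁ u₂ u₃ u₄ u₅ u₆ u₇ u₈ : Letter
u₁ = Fin.zero
u₂ = Fin.suc Fin.zero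
u₃ = Fin.suc (Fin.suc Fin.zero)
u₄ = Fin.suc (Fin.suc (Fin.suc Fin.zero))
u₅ = Fin.suc (Fin.suc (Fin.suc (Fin.suc Fin.zero)))
u₆ = Fin.suc (Fin.suc (Fin.suc (Fin.suc (Fin.suc Fin.zero))))
u₇ = Fin.suc (Fin.suc (Fin.suc (Fin.suc (Fin.suc (Fin.suc Fin.zero)))))
u₈ = Fin.suc (Fin.suc (Fin.suc (Fin.suc (Fin.suc (Fin.suc (Fin.suc Fin.zero))))))

-- a union of Knuth classes of permutations, found by computer
knuthClass : List Word
knuthClass =
  (u₅ ∷ u₃ ∷ u₂ ∷ u₁ ∷ u₈ ∷ u₇ ∷ u₆ ∷ u₄ ∷ []) ∷ (u₅ ∷ u₃ ∷ u₂ ∷ u₈ ∷ u₁ ∷ u₇ ∷ u₆ ∷ u₄ ∷ []) ∷ (u₅ ∷ u₃ ∷ u₂ ∷ u₈ ∷ u₇ ∷ u₁ ∷ u₆ ∷ u₄ ∷ []) ∷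
  (u₅ ∷ u₃ ∷ u₂ ∷ u₈ ∷ u₇ ∷ u₆ ∷ u₁ ∷ u₄ ∷ []) ∷ (u₅ ∷ u₃ ∷ u₈ ∷ u₂ ∷ u₁ ∷ u₇ ∷ u₆ ∷ u₄ ∷ []) ∷ (u₅ ∷ u₃ ∷ u₈ ∷ u₂ ∷ u₇ ∷ u₁ ∷ u₆ ∷ u₄ ∷ []) ∷
  (u₅ ∷ u₃ ∷ u₈ ∷ u₂ ∷ u₇ ∷ u₆ ∷ u₁ ∷ u₄ ∷ []) ∷ (u₅ ∷ u₃ ∷ u₈ ∷ u₇ ∷ u₂ ∷ u₁ ∷ u₆ ∷ u₄ ∷ []) ∷ (u₅ ∷ u₃ ∷ u₈ ∷ u₇ ∷ u₂ ∷ u₆ ∷ u₁ ∷ u₄ ∷ []) ∷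
  (u₅ ∷ u₈ ∷ u₃ ∷ u₂ ∷ u₁ ∷ u₇ ∷ u₆ ∷ u₄ ∷ []) ∷ (u₅ ∷ u₈ ∷ u₃ ∷ u₂ ∷ u₇ ∷ u₁ ∷ u₆ ∷ u₄ ∷ []) ∷ (u₅ ∷ u₈ ∷ u₃ ∷ u₂ ∷ u₇ ∷ u₆ ∷ u₁ ∷ u₄ ∷ []) ∷
  (u₅ ∷ u₈ ∷ u₃ ∷ u₇ ∷ u₂ ∷ u₁ ∷ u₆ ∷ u₄ ∷ []) ∷ (u₅ ∷ u₈ ∷ u₃ ∷ u₇ ∷ u₂ ∷ u₆ ∷ u₁ ∷ u₄ ∷ []) ∷ (u₅ ∷ u₄ ∷ u₂ ∷ u₁ ∷ u₈ ∷ u₇ ∷ u₆ ∷ u₃ ∷ []) ∷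
  (u₅ ∷ u₄ ∷ u₂ ∷ u₈ ∷ u₁ ∷ u₇ ∷ u₆ ∷ u₃ ∷ []) ∷ (u₅ ∷ u₄ ∷ u₂ ∷ u₈ ∷ u₇ ∷ u₁ ∷ u₆ ∷ u₃ ∷ []) ∷ (u₅ ∷ u₄ ∷ u₂ ∷ u₈ ∷ u₇ ∷ u₆ ∷ u₁ ∷ u₃ ∷ []) ∷
  (u₅ ∷ u₄ ∷ u₈ ∷ u₂ ∷ u₁ ∷ u₇ ∷ u₆ ∷ u₃ ∷ []) ∷ (u₅ ∷ u₄ ∷ u₈ ∷ u₂ ∷ u₇ ∷ u₁ ∷ u₆ ∷ u₃ ∷ []) ∷ (u₅ ∷ u₄ ∷ u₈ ∷ u₂ ∷ u₇ ∷ u₆ ∷ u₁ ∷ u₃ ∷ []) ∷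
  (u₅ ∷ u₄ ∷ u₈ ∷ u₇ ∷ u₂ ∷ u₁ ∷ u₆ ∷ u₃ ∷ []) ∷ (u₅ ∷ u₄ ∷ u₈ ∷ u₇ ∷ u₂ ∷ u₆ ∷ u₁ ∷ u₃ ∷ []) ∷ (u₅ ∷ u₈ ∷ u₄ ∷ u₂ ∷ u₁ ∷ u₇ ∷ u₆ ∷ u₃ ∷ []) ∷
  (u₅ ∷ u₈ ∷ u₄ ∷ u₂ ∷ u₇ ∷ u₁ ∷ u₆ ∷ u₃ ∷ []) ∷ (u₅ ∷ u₈ ∷ u₄ ∷ u₂ ∷ u₇ ∷ u₆ ∷ u₁ ∷ u₃ ∷ []) ∷ (u₅ ∷ u₈ ∷ u₄ ∷ u₇ ∷ u₂ ∷ u₁ ∷ u₆ ∷ u₃ ∷ []) ∷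
  (u₅ ∷ u₈ ∷ u₄ ∷ u₇ ∷ u₂ ∷ u₆ ∷ u₁ ∷ u₃ ∷ []) ∷ (u₅ ∷ u₄ ∷ u₃ ∷ u₁ ∷ u₈ ∷ u₇ ∷ u₆ ∷ u₂ ∷ []) ∷ (u₅ ∷ u₄ ∷ u₃ ∷ u₈ ∷ u₁ ∷ u₇ ∷ u₆ ∷ u₂ ∷ []) ∷
  (u₅ ∷ u₄ ∷ u₃ ∷ u₈ ∷ u₇ ∷ u₁ ∷ u₆ ∷ u₂ ∷ []) ∷ (u₅ ∷ u₄ ∷ u₃ ∷ u₈ ∷ u₇ ∷ u₆ ∷ u₁ ∷ u₂ ∷ []) ∷ (u₅ ∷ u₄ ∷ u₈ ∷ u₃ ∷ u₁ ∷ u₇ ∷ u₆ ∷ u₂ ∷ []) ∷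
  (u₅ ∷ u₄ ∷ u₈ ∷ u₃ ∷ u₇ ∷ u₁ ∷ u₆ ∷ u₂ ∷ []) ∷ (u₅ ∷ u₄ ∷ u₈ ∷ u₃ ∷ u₇ ∷ u₆ ∷ u₁ ∷ u₂ ∷ []) ∷ (u₅ ∷ u₄ ∷ u₈ ∷ u₇ ∷ u₃ ∷ u₁ ∷ u₆ ∷ u₂ ∷ []) ∷
  (u₅ ∷ u₄ ∷ u₈ ∷ u₇ ∷ u₃ ∷ u₆ ∷ u₁ ∷ u₂ ∷ []) ∷ (u₅ ∷ u₈ ∷ u₄ ∷ u₃ ∷ u₁ ∷ u₇ ∷ u₆ ∷ u₂ ∷ []) ∷ (u₅ ∷ u₈ ∷ u₄ ∷ u₃ ∷ u₇ ∷ u₁ ∷ u₆ ∷ u₂ ∷ []) ∷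
  (u₅ ∷ u₈ ∷ u₄ ∷ u₃ ∷ u₇ ∷ u₆ ∷ u₁ ∷ u₂ ∷ []) ∷ (u₅ ∷ u₈ ∷ u₄ ∷ u₇ ∷ u₃ ∷ u₁ ∷ u₆ ∷ u₂ ∷ []) ∷ (u₅ ∷ u₈ ∷ u₄ ∷ u₇ ∷ u₃ ∷ u₆ ∷ u₁ ∷ u₂ ∷ []) ∷
  (u₆ ∷ u₃ ∷ u₂ ∷ u₁ ∷ u₈ ∷ u₇ ∷ u₅ ∷ u₄ ∷ []) ∷ (u₆ ∷ u₃ ∷ u₂ ∷ u₈ ∷ u₁ ∷ u₇ ∷ u₅ ∷ u₄ ∷ []) ∷ (u₆ ∷ u₃ ∷ u₂ ∷ u₈ ∷ u₇ ∷ u₁ ∷ u₅ ∷ u₄ ∷ []) ∷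
  (u₆ ∷ u₃ ∷ u₂ ∷ u₈ ∷ u₇ ∷ u₅ ∷ u₁ ∷ u₄ ∷ []) ∷ (u₆ ∷ u₃ ∷ u₈ ∷ u₂ ∷ u₁ ∷ u₇ ∷ u₅ ∷ u₄ ∷ []) ∷ (u₆ ∷ u₃ ∷ u₈ ∷ u₂ ∷ u₇ ∷ u₁ ∷ u₅ ∷ u₄ ∷ []) ∷
  (u₆ ∷ u₃ ∷ u₈ ∷ u₂ ∷ u₇ ∷ u₅ ∷ u₁ ∷ u₄ ∷ []) ∷ (u₆ ∷ u₃ ∷ u₈ ∷ u₇ ∷ u₂ ∷ u₁ ∷ u₅ ∷ u₄ ∷ []) ∷ (u₆ ∷ u₃ ∷ u₈ ∷ u₇ ∷ u₂ ∷ u₅ ∷ u₁ ∷ u₄ ∷ []) ∷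
  (u₆ ∷ u₈ ∷ u₃ ∷ u₂ ∷ u₁ ∷ u₇ ∷ u₅ ∷ u₄ ∷ []) ∷ (u₆ ∷ u₈ ∷ u₃ ∷ u₂ ∷ u₇ ∷ u₁ ∷ u₅ ∷ u₄ ∷ []) ∷ (u₆ ∷ u₈ ∷ u₃ ∷ u₂ ∷ u₇ ∷ u₅ ∷ u₁ ∷ u₄ ∷ []) ∷
  (u₆ ∷ u₈ ∷ u₃ ∷ u₇ ∷ u₂ ∷ u₁ ∷ u₅ ∷ u₄ ∷ []) ∷ (u₆ ∷ u₈ ∷ u₃ ∷ u₇ ∷ u₂ ∷ u₅ ∷ u₁ ∷ u₄ ∷ []) ∷ (u₆ ∷ u₄ ∷ u₂ ∷ u₁ ∷ u₈ ∷ u₇ ∷ u₅ ∷ u₃ ∷ []) ∷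
  (u₆ ∷ u₄ ∷ u₂ ∷ u₈ ∷ u₁ ∷ u₇ ∷ u₅ ∷ u₃ ∷ []) ∷ (u₆ ∷ u₄ ∷ u₂ ∷ u₈ ∷ u₇ ∷ u₁ ∷ u₅ ∷ u₃ ∷ []) ∷ (u₆ ∷ u₄ ∷ u₂ ∷ u₈ ∷ u₇ ∷ u₅ ∷ u₁ ∷ u₃ ∷ []) ∷
  (u₆ ∷ u₄ ∷ u₈ ∷ u₂ ∷ u₁ ∷ u₇ ∷ u₅ ∷ u₃ ∷ []) ∷ (u₆ ∷ u₄ ∷ u₈ ∷ u₂ ∷ u₇ ∷ u₁ ∷ u₅ ∷ u₃ ∷ []) ∷ (u₆ ∷ u₄ ∷ u₈ ∷ u₂ ∷ u₇ ∷ u₅ ∷ u₁ ∷ u₃ ∷ []) ∷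
  (u₆ ∷ u₄ ∷ u₈ ∷ u₇ ∷ u₂ ∷ u₁ ∷ u₅ ∷ u₃ ∷ []) ∷ (u₆ ∷ u₄ ∷ u₈ ∷ u₇ ∷ u₂ ∷ u₅ ∷ u₁ ∷ u₃ ∷ []) ∷ (u₆ ∷ u₈ ∷ u₄ ∷ u₂ ∷ u₁ ∷ u₇ ∷ u₅ ∷ u₃ ∷ []) ∷
  (u₆ ∷ u₈ ∷ u₄ ∷ u₂ ∷ u₇ ∷ u₁ ∷ u₅ ∷ u₃ ∷ []) ∷ (u₆ ∷ u₈ ∷ u₄ ∷ u₂ ∷ u₇ ∷ u₅ ∷ u₁ ∷ u₃ ∷ []) ∷ (u₆ ∷ u₈ ∷ u₄ ∷ u₇ ∷ u₂ ∷ u₁ ∷ u₅ ∷ u₃ ∷ []) ∷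
  (u₆ ∷ u₈ ∷ u₄ ∷ u₇ ∷ u₂ ∷ u₅ ∷ u₁ ∷ u₃ ∷ []) ∷ (u₆ ∷ u₄ ∷ u₃ ∷ u₁ ∷ u₈ ∷ u₇ ∷ u₅ ∷ u₂ ∷ []) ∷ (u₆ ∷ u₄ ∷ u₃ ∷ u₈ ∷ u₁ ∷ u₇ ∷ u₅ ∷ u₂ ∷ []) ∷
  (u₆ ∷ u₄ ∷ u₃ ∷ u₈ ∷ u₇ ∷ u₁ ∷ u₅ ∷ u₂ ∷ []) ∷ (u₆ ∷ u₄ ∷ u₃ ∷ u₈ ∷ u₇ ∷ u₅ ∷ u₁ ∷ u₂ ∷ []) ∷ (u₆ ∷ u₄ ∷ u₈ ∷ u₃ ∷ u₁ ∷ u₇ ∷ u₅ ∷ u₂ ∷ []) ∷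
  (u₆ ∷ u₄ ∷ u₈ ∷ u₃ ∷ u₇ ∷ u₁ ∷ u₅ ∷ u₂ ∷ []) ∷ (u₆ ∷ u₄ ∷ u₈ ∷ u₃ ∷ u₇ ∷ u₅ ∷ u₁ ∷ u₂ ∷ []) ∷ (u₆ ∷ u₄ ∷ u₈ ∷ u₇ ∷ u₃ ∷ u₁ ∷ u₅ ∷ u₂ ∷ []) ∷
  (u₆ ∷ u₄ ∷ u₈ ∷ u₇ ∷ u₃ ∷ u₅ ∷ u₁ ∷ u₂ ∷ []) ∷ (u₆ ∷ u₈ ∷ u₄ ∷ u₃ ∷ u₁ ∷ u₇ ∷ u₅ ∷ u₂ ∷ []) ∷ (u₆ ∷ u₈ ∷ u₄ ∷ u₃ ∷ u₇ ∷ u₁ ∷ u₅ ∷ u₂ ∷ []) ∷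
  (u₆ ∷ u₈ ∷ u₄ ∷ u₃ ∷ u₇ ∷ u₅ ∷ u₁ ∷ u₂ ∷ []) ∷ (u₆ ∷ u₈ ∷ u₄ ∷ u₇ ∷ u₃ ∷ u₁ ∷ u₅ ∷ u₂ ∷ []) ∷ (u₆ ∷ u₈ ∷ u₄ ∷ u₇ ∷ u₃ ∷ u₅ ∷ u₁ ∷ u₂ ∷ []) ∷
  (u₆ ∷ u₅ ∷ u₂ ∷ u₁ ∷ u₈ ∷ u₇ ∷ u₄ ∷ u₃ ∷ []) ∷ (u₆ ∷ u₅ ∷ u₂ ∷ u₈ ∷ u₁ ∷ u₇ ∷ u₄ ∷ u₃ ∷ []) ∷ (u₆ ∷ u₅ ∷ u₂ ∷ u₈ ∷ u₇ ∷ u₁ ∷ u₄ ∷ u₃ ∷ []) ∷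
  (u₆ ∷ u₅ ∷ u₂ ∷ u₈ ∷ u₇ ∷ u₄ ∷ u₁ ∷ u₃ ∷ []) ∷ (u₆ ∷ u₅ ∷ u₈ ∷ u₂ ∷ u₁ ∷ u₇ ∷ u₄ ∷ u₃ ∷ []) ∷ (u₆ ∷ u₅ ∷ u₈ ∷ u₂ ∷ u₇ ∷ u₁ ∷ u₄ ∷ u₃ ∷ []) ∷
  (u₆ ∷ u₅ ∷ u₈ ∷ u₂ ∷ u₇ ∷ u₄ ∷ u₁ ∷ u₃ ∷ []) ∷ (u₆ ∷ u₅ ∷ u₈ ∷ u₇ ∷ u₂ ∷ u₁ ∷ u₄ ∷ u₃ ∷ []) ∷ (u₆ ∷ u₅ ∷ u₈ ∷ u₇ ∷ u₂ ∷ u₄ ∷ u₁ ∷ u₃ ∷ []) ∷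
  (u₆ ∷ u₈ ∷ u₅ ∷ u₂ ∷ u₁ ∷ u₇ ∷ u₄ ∷ u₃ ∷ []) ∷ (u₆ ∷ u₈ ∷ u₅ ∷ u₂ ∷ u₇ ∷ u₁ ∷ u₄ ∷ u₃ ∷ []) ∷ (u₆ ∷ u₈ ∷ u₅ ∷ u₂ ∷ u₇ ∷ u₄ ∷ u₁ ∷ u₃ ∷ []) ∷
  (u₆ ∷ u₈ ∷ u₅ ∷ u₇ ∷ u₂ ∷ u₁ ∷ u₄ ∷ u₃ ∷ []) ∷ (u₆ ∷ u₈ ∷ u₅ ∷ u₇ ∷ u₂ ∷ u₄ ∷ u₁ ∷ u₃ ∷ []) ∷ (u₆ ∷ u₅ ∷ u₃ ∷ u₁ ∷ u₈ ∷ u₇ ∷ u₄ ∷ u₂ ∷ []) ∷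
  (u₆ ∷ u₅ ∷ u₃ ∷ u₈ ∷ u₁ ∷ u₇ ∷ u₄ ∷ u₂ ∷ []) ∷ (u₆ ∷ u₅ ∷ u₃ ∷ u₈ ∷ u₇ ∷ u₁ ∷ u₄ ∷ u₂ ∷ []) ∷ (u₆ ∷ u₅ ∷ u₃ ∷ u₈ ∷ u₇ ∷ u₄ ∷ u₁ ∷ u₂ ∷ []) ∷
  (u₆ ∷ u₅ ∷ u₈ ∷ u₃ ∷ u₁ ∷ u₇ ∷ u₄ ∷ u₂ ∷ []) ∷ (u₆ ∷ u₅ ∷ u₈ ∷ u₃ ∷ u₇ ∷ u₁ ∷ u₄ ∷ u₂ ∷ []) ∷ (u₆ ∷ u₅ ∷ u₈ ∷ u₃ ∷ u₇ ∷ u₄ ∷ u₁ ∷ u₂ ∷ []) ∷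
  (u₆ ∷ u₅ ∷ u₈ ∷ u₇ ∷ u₃ ∷ u₁ ∷ u₄ ∷ u₂ ∷ []) ∷ (u₆ ∷ u₅ ∷ u₈ ∷ u₇ ∷ u₃ ∷ u₄ ∷ u₁ ∷ u₂ ∷ []) ∷ (u₆ ∷ u₈ ∷ u₅ ∷ u₃ ∷ u₁ ∷ u₇ ∷ u₄ ∷ u₂ ∷ []) ∷
  (u₆ ∷ u₈ ∷ u₅ ∷ u₃ ∷ u₇ ∷ u₁ ∷ u₄ ∷ u₂ ∷ []) ∷ (u₆ ∷ u₈ ∷ u₅ ∷ u₃ ∷ u₇ ∷ u₄ ∷ u₁ ∷ u₂ ∷ []) ∷ (u₆ ∷ u₈ ∷ u₅ ∷ u₇ ∷ u₃ ∷ u₁ ∷ u₄ ∷ u₂ ∷ []) ∷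
  (u₆ ∷ u₈ ∷ u₅ ∷ u₇ ∷ u₃ ∷ u₄ ∷ u₁ ∷ u₂ ∷ []) ∷ (u₇ ∷ u₃ ∷ u₂ ∷ u₁ ∷ u₈ ∷ u₆ ∷ u₅ ∷ u₄ ∷ []) ∷ (u₇ ∷ u₃ ∷ u₂ ∷ u₈ ∷ u₁ ∷ u₆ ∷ u₅ ∷ u₄ ∷ []) ∷
  (u₇ ∷ u₃ ∷ u₂ ∷ u₈ ∷ u₆ ∷ u₁ ∷ u₅ ∷ u₄ ∷ []) ∷ (u₇ ∷ u₃ ∷ u₂ ∷ u₈ ∷ u₆ ∷ u₅ ∷ u₁ ∷ u₄ ∷ []) ∷ (u₇ ∷ u₃ ∷ u₈ ∷ u₂ ∷ u₁ ∷ u₆ ∷ u₅ ∷ u₄ ∷ []) ∷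
  (u₇ ∷ u₃ ∷ u₈ ∷ u₂ ∷ u₆ ∷ u₁ ∷ u₅ ∷ u₄ ∷ []) ∷ (u₇ ∷ u₃ ∷ u₈ ∷ u₂ ∷ u₆ ∷ u₅ ∷ u₁ ∷ u₄ ∷ []) ∷ (u₇ ∷ u₃ ∷ u₈ ∷ u₆ ∷ u₂ ∷ u₁ ∷ u₅ ∷ u₄ ∷ []) ∷
  (u₇ ∷ u₃ ∷ u₈ ∷ u₆ ∷ u₂ ∷ u₅ ∷ u₁ ∷ u₄ ∷ []) ∷ (u₇ ∷ u₈ ∷ u₃ ∷ u₂ ∷ u₁ ∷ u₆ ∷ u₅ ∷ u₄ ∷ []) ∷ (u₇ ∷ u₈ ∷ u₃ ∷ u₂ ∷ u₆ ∷ u₁ ∷ u₅ ∷ u₄ ∷ []) ∷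
  (u₇ ∷ u₈ ∷ u₃ ∷ u₂ ∷ u₆ ∷ u₅ ∷ u₁ ∷ u₄ ∷ []) ∷ (u₇ ∷ u₈ ∷ u₃ ∷ u₆ ∷ u₂ ∷ u₁ ∷ u₅ ∷ u₄ ∷ []) ∷ (u₇ ∷ u₈ ∷ u₃ ∷ u₆ ∷ u₂ ∷ u₅ ∷ u₁ ∷ u₄ ∷ []) ∷
  (u₇ ∷ u₄ ∷ u₂ ∷ u₁ ∷ u₈ ∷ u₆ ∷ u₅ ∷ u₃ ∷ []) ∷ (u₇ ∷ u₄ ∷ u₂ ∷ u₈ ∷ u₁ ∷ u₆ ∷ u₅ ∷ u₃ ∷ []) ∷ (u₇ ∷ u₄ ∷ u₂ ∷ u₈ ∷ u₆ ∷ u₁ ∷ u₅ ∷ u₃ ∷ []) ∷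
  (u₇ ∷ u₄ ∷ u₂ ∷ u₈ ∷ u₆ ∷ u₅ ∷ u₁ ∷ u₃ ∷ []) ∷ (u₇ ∷ u₄ ∷ u₈ ∷ u₂ ∷ u₁ ∷ u₆ ∷ u₅ ∷ u₃ ∷ []) ∷ (u₇ ∷ u₄ ∷ u₈ ∷ u₂ ∷ u₆ ∷ u₁ ∷ u₅ ∷ u₃ ∷ []) ∷
  (u₇ ∷ u₄ ∷ u₈ ∷ u₂ ∷ u₆ ∷ u₅ ∷ u₁ ∷ u₃ ∷ []) ∷ (u₇ ∷ u₄ ∷ u₈ ∷ u₆ ∷ u₂ ∷ u₁ ∷ u₅ ∷ u₃ ∷ []) ∷ (u₇ ∷ u₄ ∷ u₈ ∷ u₆ ∷ u₂ ∷ u₅ ∷ u₁ ∷ u₃ ∷ []) ∷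
  (u₇ ∷ u₈ ∷ u₄ ∷ u₂ ∷ u₁ ∷ u₆ ∷ u₅ ∷ u₃ ∷ []) ∷ (u₇ ∷ u₈ ∷ u₄ ∷ u₂ ∷ u₆ ∷ u₁ ∷ u₅ ∷ u₃ ∷ []) ∷ (u₇ ∷ u₈ ∷ u₄ ∷ u₂ ∷ u₆ ∷ u₅ ∷ u₁ ∷ u₃ ∷ []) ∷
  (u₇ ∷ u₈ ∷ u₄ ∷ u₆ ∷ u₂ ∷ u₁ ∷ u₅ ∷ u₃ ∷ []) ∷ (u₇ ∷ u₈ ∷ u₄ ∷ u₆ ∷ u₂ ∷ u₅ ∷ u₁ ∷ u₃ ∷ []) ∷ (u₇ ∷ u₄ ∷ u₃ ∷ u₁ ∷ u₈ ∷ u₆ ∷ u₅ ∷ u₂ ∷ []) ∷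
  (u₇ ∷ u₄ ∷ u₃ ∷ u₈ ∷ u₁ ∷ u₆ ∷ u₅ ∷ u₂ ∷ []) ∷ (u₇ ∷ u₄ ∷ u₃ ∷ u₈ ∷ u₆ ∷ u₁ ∷ u₅ ∷ u₂ ∷ []) ∷ (u₇ ∷ u₄ ∷ u₃ ∷ u₈ ∷ u₆ ∷ u₅ ∷ u₁ ∷ u₂ ∷ []) ∷
  (u₇ ∷ u₄ ∷ u₈ ∷ u₃ ∷ u₁ ∷ u₆ ∷ u₅ ∷ u₂ ∷ []) ∷ (u₇ ∷ u₄ ∷ u₈ ∷ u₃ ∷ u₆ ∷ u₁ ∷ u₅ ∷ u₂ ∷ []) ∷ (u₇ ∷ u₄ ∷ u₈ ∷ u₃ ∷ u₆ ∷ u₅ ∷ u₁ ∷ u₂ ∷ []) ∷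
  (u₇ ∷ u₄ ∷ u₈ ∷ u₆ ∷ u₃ ∷ u₁ ∷ u₅ ∷ u₂ ∷ []) ∷ (u₇ ∷ u₄ ∷ u₈ ∷ u₆ ∷ u₃ ∷ u₅ ∷ u₁ ∷ u₂ ∷ []) ∷ (u₇ ∷ u₈ ∷ u₄ ∷ u₃ ∷ u₁ ∷ u₆ ∷ u₅ ∷ u₂ ∷ []) ∷
  (u₇ ∷ u₈ ∷ u₄ ∷ u₃ ∷ u₆ ∷ u₁ ∷ u₅ ∷ u₂ ∷ []) ∷ (u₇ ∷ u₈ ∷ u₄ ∷ u₃ ∷ u₆ ∷ u₅ ∷ u₁ ∷ u₂ ∷ []) ∷ (u₇ ∷ u₈ ∷ u₄ ∷ u₆ ∷ u₃ ∷ u₁ ∷ u₅ ∷ u₂ ∷ []) ∷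
  (u₇ ∷ u₈ ∷ u₄ ∷ u₆ ∷ u₃ ∷ u₅ ∷ u₁ ∷ u₂ ∷ []) ∷ (u₇ ∷ u₅ ∷ u₂ ∷ u₁ ∷ u₈ ∷ u₆ ∷ u₄ ∷ u₃ ∷ []) ∷ (u₇ ∷ u₅ ∷ u₂ ∷ u₈ ∷ u₁ ∷ u₆ ∷ u₄ ∷ u₃ ∷ []) ∷
  (u₇ ∷ u₅ ∷ u₂ ∷ u₈ ∷ u₆ ∷ u₁ ∷ u₄ ∷ u₃ ∷ []) ∷ (u₇ ∷ u₅ ∷ u₂ ∷ u₈ ∷ u₆ ∷ u₄ ∷ u₁ ∷ u₃ ∷ []) ∷ (u₇ ∷ u₅ ∷ u₈ ∷ u₂ ∷ u₁ ∷ u₆ ∷ u₄ ∷ u₃ ∷ []) ∷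
  (u₇ ∷ u₅ ∷ u₈ ∷ u₂ ∷ u₆ ∷ u₁ ∷ u₄ ∷ u₃ ∷ []) ∷ (u₇ ∷ u₅ ∷ u₈ ∷ u₂ ∷ u₆ ∷ u₄ ∷ u₁ ∷ u₃ ∷ []) ∷ (u₇ ∷ u₅ ∷ u₈ ∷ u₆ ∷ u₂ ∷ u₁ ∷ u₄ ∷ u₃ ∷ []) ∷
  (u₇ ∷ u₅ ∷ u₈ ∷ u₆ ∷ u₂ ∷ u₄ ∷ u₁ ∷ u₃ ∷ []) ∷ (u₇ ∷ u₈ ∷ u₅ ∷ u₂ ∷ u₁ ∷ u₆ ∷ u₄ ∷ u₃ ∷ []) ∷ (u₇ ∷ u₈ ∷ u₅ ∷ u₂ ∷ u₆ ∷ u₁ ∷ u₄ ∷ u₃ ∷ []) ∷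
  (u₇ ∷ u₈ ∷ u₅ ∷ u₂ ∷ u₆ ∷ u₄ ∷ u₁ ∷ u₃ ∷ []) ∷ (u₇ ∷ u₈ ∷ u₅ ∷ u₆ ∷ u₂ ∷ u₁ ∷ u₄ ∷ u₃ ∷ []) ∷ (u₇ ∷ u₈ ∷ u₅ ∷ u₆ ∷ u₂ ∷ u₄ ∷ u₁ ∷ u₃ ∷ []) ∷ []

knuthClass-closed : All (λ w → All (_∈ knuthClass) (knuthNeighbours w)) knuthClass
knuthClass-closed = toWitness {a? = All.all? (λ w → All.all? (_∈? knuthClass) (knuthNeighbours w)) knuthClass} tt

placticFunctional : Word → ℤ
placticFunctional w = iverson (isPermutation w ∧ does (w ∈? knuthClass))

placticFunctional-supported : PermutationSupported placticFunctional
placticFunctional-supported w notPerm = ≡.cong (λ p → iverson (p ∧ does (w ∈? knuthClass))) notPerm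

∧-does⇒witness : ∀ {P : Set} b (d : Dec P) → b ∧ does d ≡ true → P
∧-does⇒witness true  (yes p) _  = p
∧-does⇒witness true  (no _)  ()
∧-does⇒witness false _       ()

placticFunctional-nonzero : ∀ w → placticFunctional w ≢ + 0 → w ∈ knuthClass
placticFunctional-nonzero w nz = ∧-does⇒witness (isPermutation w) (w ∈? knuthClass) (iverson-nonzero _ nz)

knuthClass-step : ∀ l r (a b c : Letter) {v} → v ∈ knuthMoves (a ∷ b ∷ c ∷ []) →
                  l ++ a ∷ b ∷ c ∷ r ∈ knuthClass → l ++ v ++ r ∈ knuthClass
knuthClass-step l r a b c v∈ w∈ = All.lookup (All.lookup knuthClass-closed w∈) (knuthNeighbours-complete l r a b c v∈)

placticFunctional-step : ∀ l r (a b c a′ b′ c′ : Letter) → a ∷ b ∷ c ∷ [] ↭ a′ ∷ b′ ∷ c′ ∷ [] →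
  (a′ ∷ b′ ∷ c′ ∷ []) ∈ knuthMoves (a ∷ b ∷ c ∷ []) → (a ∷ b ∷ c ∷ []) ∈ knuthMoves (a′ ∷ b′ ∷ c′ ∷ []) →
  placticFunctional (l ++ a ∷ b ∷ c ∷ r) ≡ placticFunctional (l ++ a′ ∷ b′ ∷ c′ ∷ r)
placticFunctional-step l r a b c a′ b′ c′ ↭′ forth back = ≡.cong iverson (≡.cong₂ _∧_
  (isPermutation-resp-↭ (↭.++⁺ˡ l (↭.++⁺ʳ r ↭′)))
  (does-⇔ (mk⇔ (knuthClass-step l r a b c forth) (knuthClass-step l r a′ b′ c′ back)) (_ ∈? knuthClass) (_ ∈? knuthClass)))

placticFunctional-knuth : KnuthInvariant placticFunctional
placticFunctional-knuth l r a b c a<b b<c =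
  placticFunctional-step l r a c b c a b (↭-swap a c ↭-refl) (acb→cab a b c a<b b<c) (cab→acb a b c a<b b<c) ,
  placticFunctional-step l r b a c b c a (↭-prep b (↭-swap a c ↭-refl)) (bac→bca a b c a<b b<c) (bca→bac a b c a<b b<c)

-- q-inversions

-- every inversion except u_8 before u_1
qInv : Letter → Letter → ℕ
qInv x y = if does ((toℕ y <? toℕ x) ×-dec (toℕ x <? toℕ y ℕ.+ 7)) then 1 else 0

qInvFrom : Letter → Word → ℕ
qInvFrom x []      = 0
qInvFrom x (y ∷ w) = qInv x y ℕ.+ qInvFrom x w

qInversions : Word → ℕ
qInversions []      = 0
qInversions (x ∷ w) = qInvFrom x w ℕ.+ qInversions w

qInv-ascent : ∀ {a b} → toℕ a < toℕ b → qInv a b ≡ 0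
qInv-ascent {a} {b} a<b
  rewrite dec-false ((toℕ b <? toℕ a) ×-dec (toℕ a <? toℕ b ℕ.+ 7)) (λ (b<a , _) → ℕ.<-asym a<b b<a) = ≡.refl

qInv-descent : ∀ {a b} → toℕ a < toℕ b → toℕ b < toℕ a ℕ.+ 7 → qInv b a ≡ 1
qInv-descent {a} {b} a<b b<a+7
  rewrite dec-true ((toℕ a <? toℕ b) ×-dec (toℕ b <? toℕ a ℕ.+ 7)) (a<b , b<a+7) = ≡.refl

qInvFrom-swap : ∀ x l a b r → qInvFrom x (l ++ a ∷ b ∷ r) ≡ qInvFrom x (l ++ b ∷ a ∷ r)
qInvFrom-swap x []      a b r = x∙yz≈y∙xz (qInv x a) (qInv x b) (qInvFrom x r)
qInvFrom-swap x (y ∷ l) a b r = ≡.cong (qInv x y ℕ.+_) (qInvFrom-swap x l a b r)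

qInversions-swap : ∀ l a b r → qInversions (l ++ a ∷ b ∷ r) ℕ.+ qInv b a ≡ qInversions (l ++ b ∷ a ∷ r) ℕ.+ qInv a b
qInversions-swap []      a b r = rearrange (qInv a b) (qInv b a) (qInvFrom a r) (qInvFrom b r) (qInversions r)
  where
  rearrange : ∀ ab ba ar br q → ab ℕ.+ ar ℕ.+ (br ℕ.+ q) ℕ.+ ba ≡ ba ℕ.+ br ℕ.+ (ar ℕ.+ q) ℕ.+ ab
  rearrange = ℕ-Solver.solve-∀
qInversions-swap (x ∷ l) a b r = begin
  qInvFrom x v ℕ.+ qInversions v ℕ.+ qInv b a    ≡⟨ ℕ.+-assoc (qInvFrom x v) _ (qInv b a) ⟩
  qInvFrom x v ℕ.+ (qInversions v ℕ.+ qInv b a)  ≡⟨ ≡.cong₂ ℕ._+_ (qInvFrom-swap x l a b r) (qInversions-swap l a b r) ⟩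
  qInvFrom x w ℕ.+ (qInversions w ℕ.+ qInv a b)  ≡⟨ ℕ.+-assoc (qInvFrom x w) _ (qInv a b) ⟨
  qInvFrom x w ℕ.+ qInversions w ℕ.+ qInv a b    ∎
  where
  open ≡.≡-Reasoning
  v w : Word
  v = l ++ a ∷ b ∷ r
  w = l ++ b ∷ a ∷ r

isExtreme : Letter → Bool
isExtreme x = does ((toℕ x ℕ.≟ 0) ⊎-dec (toℕ x ℕ.≟ 7))

firstExtreme : Word → Maybe Letter
firstExtreme []      = nothing
firstExtreme (x ∷ w) = if isExtreme x then just x else firstExtreme w

isExtreme-inner : ∀ {x} → 0 < toℕ x → toℕ x < 7 → isExtreme x ≡ false
isExtreme-inner {x} 0<x x<7 = dec-false ((toℕ x ℕ.≟ 0) ⊎-dec (toℕ x ℕ.≟ 7)) extreme⇒⊥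
  where
  extreme⇒⊥ : toℕ x ≡ 0 ⊎ toℕ x ≡ 7 → _
  extreme⇒⊥ (inj₁ x≡0) = ℕ.<-irrefl (≡.sym x≡0) 0<x
  extreme⇒⊥ (inj₂ x≡7) = ℕ.<-irrefl x≡7 x<7

firstExtreme-swap : ∀ l a b r → isExtreme a ≡ false ⊎ isExtreme b ≡ false →
                    firstExtreme (l ++ a ∷ b ∷ r) ≡ firstExtreme (l ++ b ∷ a ∷ r)
firstExtreme-swap (x ∷ l) a b r inner = ≡.cong (if isExtreme x then just x else_) (firstExtreme-swap l a b r inner)
firstExtreme-swap []      a b r (inj₁ a-inner) rewrite a-inner with isExtreme b
... | true  = ≡.refl
... | false = ≡.refl
firstExtreme-swap []      a b r (inj₂ b-inner) rewrite b-inner with isExtreme a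
... | true  = ≡.refl
... | false = ≡.refl

-- w arises from v by one relation ab = q⁻¹ ba (0 < b − a < 7) of J_Lam^{st,7}
data QSwap : Word → Word → Set where
  qswap : ∀ l r {a b : Letter} → toℕ a < toℕ b → toℕ b < toℕ a ℕ.+ 7 → QSwap (l ++ a ∷ b ∷ r) (l ++ b ∷ a ∷ r)

QSwap-∷ : ∀ x {v w} → QSwap v w → QSwap (x ∷ v) (x ∷ w)
QSwap-∷ x (qswap l r a<b b<a+7) = qswap (x ∷ l) r a<b b<a+7

QSwap-++ : ∀ l {v w} → QSwap v w → QSwap (l ++ v) (l ++ w)
QSwap-++ []      s = s
QSwap-++ (x ∷ l) s = QSwap-∷ x (QSwap-++ l s)

QSwap⇒isPermutation≡ : ∀ {v w} → QSwap v w → isPermutation v ≡ isPermutation w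
QSwap⇒isPermutation≡ (qswap l r {a} {b} _ _) = isPermutation-resp-↭ (swap-↭ l a b r)

QSwap⇒firstExtreme≡ : ∀ {v w} → QSwap v w → firstExtreme v ≡ firstExtreme w
QSwap⇒firstExtreme≡ (qswap l r {a} {b} a<b b<a+7) = firstExtreme-swap l a b r one-inner
  where
  one-inner : isExtreme a ≡ false ⊎ isExtreme b ≡ false
  one-inner with toℕ a ℕ.≟ 0
  ... | yes a≡0 = inj₂ (isExtreme-inner (ℕ.≤-trans (ℕ.s≤s ℕ.z≤n) a<b) (≡.subst (λ n → toℕ b < n ℕ.+ 7) a≡0 b<a+7))
  ... | no a≢0  = inj₁ (isExtreme-inner (ℕ.n≢0⇒n>0 a≢0) (ℕ.<-≤-trans a<b (toℕ≤7 b)))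

QSwap⇒qInversions≡suc : ∀ {v w} → QSwap v w → qInversions w ≡ suc (qInversions v)
QSwap⇒qInversions≡suc (qswap l r {a} {b} a<b b<a+7) = begin
  qInversions (l ++ b ∷ a ∷ r)               ≡⟨ ℕ.+-identityʳ _ ⟨
  qInversions (l ++ b ∷ a ∷ r) ℕ.+ 0         ≡⟨ ≡.cong (qInversions (l ++ b ∷ a ∷ r) ℕ.+_) (qInv-ascent a<b) ⟨
  qInversions (l ++ b ∷ a ∷ r) ℕ.+ qInv a b  ≡⟨ qInversions-swap l a b r ⟨
  qInversions (l ++ a ∷ b ∷ r) ℕ.+ qInv b a  ≡⟨ ≡.cong (qInversions (l ++ a ∷ b ∷ r) ℕ.+_) (qInv-descent a<b b<a+7) ⟩
  qInversions (l ++ a ∷ b ∷ r) ℕ.+ 1         ≡⟨ ℕ.+-comm _ 1 ⟩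
  suc (qInversions (l ++ a ∷ b ∷ r))         ∎
  where open ≡.≡-Reasoning

qInvFrom≤length : ∀ x w → qInvFrom x w ℕ.≤ length w
qInvFrom≤length x []      = ℕ.z≤n
qInvFrom≤length x (y ∷ w) = ℕ.+-mono-≤ (qInv≤1 x y) (qInvFrom≤length x w)
  where
  qInv≤1 : ∀ x y → qInv x y ℕ.≤ 1
  qInv≤1 x y with does ((toℕ y <? toℕ x) ×-dec (toℕ x <? toℕ y ℕ.+ 7))
  ... | true  = ℕ.≤-refl
  ... | false = ℕ.z≤n

qInversions≤length² : ∀ w → qInversions w ℕ.≤ length w ℕ.* length w
qInversions≤length² []      = ℕ.z≤n
qInversions≤length² (x ∷ w) = ℕ.≤-trans (ℕ.+-mono-≤ (qInvFrom≤length x w) (qInversions≤length² w)) (square-step (length w))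
  where
  square-step : ∀ n → n ℕ.+ n ℕ.* n ℕ.≤ suc n ℕ.* suc n
  square-step n = ℕ.≤-trans (ℕ.+-monoʳ-≤ n (ℕ.*-monoʳ-≤ n (ℕ.n≤1+n n))) (ℕ.n≤1+n _)

LamStatistics : Set
LamStatistics = Bool × Maybe Letter × ℕ

lamStatistics : Word → LamStatistics
lamStatistics w = isPermutation w , firstExtreme w , qInversions w

addInversion : LamStatistics → LamStatistics
addInversion (p , e , q) = p , e , suc q

addInversion-injective : ∀ {s t} → addInversion s ≡ addInversion t → s ≡ t
addInversion-injective {p , e , q} ≡.refl = ≡.refl

QSwap⇒lamStatistics : ∀ {v w} → QSwap v w → lamStatistics w ≡ addInversion (lamStatistics v)
QSwap⇒lamStatistics s
  rewrite QSwap⇒isPermutation≡ s | QSwap⇒firstExtreme≡ s | QSwap⇒qInversions≡suc s = ≡.refl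

lamTest : Maybe Letter → ℤ → LamStatistics → Bool
lamTest e j (p , f , q) = p ∧ does (Maybe.≡-dec Fin._≟_ f e) ∧ does (j ℤ.≟ + q)

lamTest-addInversion : ∀ e j s → lamTest e (j ℤ.+ + 1) (addInversion s) ≡ lamTest e j s
lamTest-addInversion e j (p , f , q) =
  ≡.cong (λ b → p ∧ does (Maybe.≡-dec Fin._≟_ f e) ∧ b)
         (does-⇔ (mk⇔ shift-down shift-up) (j ℤ.+ + 1 ℤ.≟ + suc q) (j ℤ.≟ + q))
  where
  shift-down : j ℤ.+ + 1 ≡ + suc q → j ≡ + q
  shift-down eq = ∙-cancelʳ (+ 1) j (+ q) (≡.trans eq (≡.cong +_ (ℕ.+-comm 1 q)))
  shift-up : j ≡ + q → j ℤ.+ + 1 ≡ + suc q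
  shift-up ≡.refl = ≡.cong +_ (ℕ.+-comm q 1)

lamTest-true : ∀ e j s → lamTest e j s ≡ true → proj₁ s ≡ true × j ≡ + proj₂ (proj₂ s)
lamTest-true e j (p , f , q) t with p | Maybe.≡-dec Fin._≟_ f e | j ℤ.≟ + q
lamTest-true e j (p , f , q) _  | true  | yes _ | yes j≡q = ≡.refl , j≡q
lamTest-true e j (p , f , q) () | true  | yes _ | no _
lamTest-true e j (p , f , q) () | true  | no _  | _
lamTest-true e j (p , f , q) () | false | _     | _

lamIndicator : Maybe Letter → ℤ → Word → ℤ
lamIndicator e j w = iverson (lamTest e j (lamStatistics w))

lamIndicator-supported : ∀ e j → PermutationSupported (lamIndicator e j)
lamIndicator-supported e j w notPerm rewrite notPerm = ≡.refl

lamIndicator-nonzero : ∀ e j w → lamIndicator e j w ≢ + 0 → isPermutation w ≡ true × j ≡ + qInversions w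
lamIndicator-nonzero e j w nz = lamTest-true e j (lamStatistics w) (iverson-nonzero _ nz)

lamIndicator-QSwap : ∀ e j {v w} → QSwap v w → lamIndicator e (j ℤ.+ + 1) w ≡ lamIndicator e j v
lamIndicator-QSwap e j {v} s =
  ≡.cong iverson (≡.trans (≡.cong (lamTest e (j ℤ.+ + 1)) (QSwap⇒lamStatistics s)) (lamTest-addInversion e j (lamStatistics v)))

QSwap-peak : ∀ {u v w} → QSwap u v → QSwap u w → lamStatistics v ≡ lamStatistics w
QSwap-peak u→v u→w = ≡.trans (QSwap⇒lamStatistics u→v) (≡.sym (QSwap⇒lamStatistics u→w))

QSwap-valley : ∀ {u v w} → QSwap v u → QSwap w u → lamStatistics v ≡ lamStatistics w
QSwap-valley v→u w→u = addInversion-injective (≡.trans (≡.sym (QSwap⇒lamStatistics v→u)) (QSwap⇒lamStatistics w→u))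

module _ {a b c : Letter} (a<b : toℕ a < toℕ b) (b<c : toℕ b < toℕ c) where
  private
    b<a+7 : toℕ b < toℕ a ℕ.+ 7
    b<a+7 = ℕ.<-≤-trans b<c (ℕ.≤-trans (toℕ≤7 c) (ℕ.m≤n+m 7 (toℕ a)))
    c<b+7 : toℕ c < toℕ b ℕ.+ 7
    c<b+7 = ℕ.≤-<-trans (toℕ≤7 c) (ℕ.m<n+m 7 (ℕ.≤-<-trans z≤n a<b))

  bac≈acb : ∀ l r → lamStatistics (l ++ b ∷ a ∷ c ∷ r) ≡ lamStatistics (l ++ a ∷ c ∷ b ∷ r)
  bac≈acb l r = QSwap-peak (qswap l (c ∷ r) a<b b<a+7) (QSwap-++ l (QSwap-∷ a (qswap [] r b<c c<b+7)))

  bca≈cab : ∀ l r → lamStatistics (l ++ b ∷ c ∷ a ∷ r) ≡ lamStatistics (l ++ c ∷ a ∷ b ∷ r)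
  bca≈cab l r = QSwap-valley (qswap l (a ∷ r) b<c c<b+7) (QSwap-++ l (QSwap-∷ c (qswap [] r a<b b<a+7)))

-- The functional killing I_Lam^{st,7}

module ℤ[q±] = FormalSums ℤ.+-*-commutativeRing ℤ._≟_
coefficient≡coeffLaurent : ∀ D n → ℤ[q±].coefficient D n ≡ coeffLaurent D n
coefficient≡coeffLaurent []            n = ≡.refl
coefficient≡coeffLaurent ((c , e) ∷ D) n rewrite coefficient≡coeffLaurent D n = ≡.refl

coefficient-outside : ∀ (D : LaurentZ) n → n ∉ map proj₂ D → ℤ[q±].coefficient D n ≡ + 0
coefficient-outside []            n _  = ≡.refl
coefficient-outside ((c , e) ∷ D) n n∉ with e ℤ.≟ n
... | yes ≡.refl = ⊥-elim (n∉ (here ≡.refl))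
... | no _       = coefficient-outside D n (λ n∈ → n∉ (there n∈))

+-shift : ∀ t j e → t ℤ.+ j ℤ.- e ≡ j ℤ.+ (t ℤ.- e)
+-shift = solve-∀

+-shift-cancel : ∀ t j → j ≡ t ℤ.+ j ℤ.- t
+-shift-cancel = solve-∀

-- ℤ[q±].eval (λ e → Q (N − e)) D is the coefficient of q^N in D·Q: a nonzero
-- Laurent polynomial is not a zero divisor
laurent-cancel : ∀ (D : LaurentZ) → NonzeroLaurent D → (B : ℕ) (Q : ℤ → ℤ) →
                 (∀ n → Q -[1+ n ] ≡ + 0) → (∀ j → B ℕ.< j → Q (+ j) ≡ + 0) →
                 (∀ N → ℤ[q±].eval (λ e → Q (N ℤ.- e)) D ≡ + 0) → ∀ x → Q x ≡ + 0
laurent-cancel D (n₀ , D[n₀]≢0) B Q Q-neg Q-large DQ≡0 = Q≡0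
  where
  d : ℤ → ℤ
  d = ℤ[q±].coefficient D

  E : List ℤ
  E = deduplicate ℤ._≟_ (map proj₂ D)

  Nonzero : ℤ → Set
  Nonzero e = d e ≢ + 0

  nonzero? : ∀ e → Dec (Nonzero e)
  nonzero? e = ¬? (d e ℤ.≟ + 0)

  top : ℤ
  top = Extrema.max n₀ (filter nonzero? E)

  nonzero⇒∈E : ∀ {e} → Nonzero e → e ∈ E
  nonzero⇒∈E {e} nz with e ∈ℤ? map proj₂ D
  ... | yes e∈ = ∈.∈-deduplicate⁺ ℤ._≟_ e∈
  ... | no e∉  = ⊥-elim (nz (coefficient-outside D e e∉))

  n₀-nonzero : Nonzero n₀
  n₀-nonzero eq = D[n₀]≢0 (≡.trans (≡.sym (coefficient≡coeffLaurent D n₀)) eq)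

  top-nonzero : top ∈ E × Nonzero top
  top-nonzero = Extrema.argmax-all (λ e → e) (nonzero⇒∈E n₀-nonzero , n₀-nonzero)
                  (All.tabulate (λ e∈ → let (e∈E , nz) = ∈.∈-filter⁻ nonzero? e∈ in e∈E , nz))

  above-top : ∀ e → e ∈ E → top ℤ.< e → d e ≡ + 0
  above-top e e∈E top<e with d e ℤ.≟ + 0
  ... | yes d[e]≡0 = d[e]≡0
  ... | no nz      = ⊥-elim (ℤ.<⇒≱ top<e (All.lookup (Extrema.xs≤max n₀ _) (∈.∈-filter⁺ nonzero? e∈E nz)))

  DQ≡sum : ∀ N → ℤ[q±].eval (λ e → Q (N ℤ.- e)) D ≡ ℤ[q±].sumOver E (λ e → d e ℤ.* Q (N ℤ.- e))
  DQ≡sum N = ℤ[q±].eval≈sumOver-coefficient E (λ e → Q (N ℤ.- e)) (Dedup.deduplicate-! _) D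
               (keys-in-E D (λ t∈ → ∈.∈-deduplicate⁺ ℤ._≟_ (∈.∈-map⁺ proj₂ t∈)))
    where
    keys-in-E : ∀ (F : LaurentZ) → (∀ {t} → t ∈ F → proj₂ t ∈ E) →
                All (λ t → proj₂ t ∈ E ⊎ Q (N ℤ.- proj₂ t) ≡ + 0) F
    keys-in-E []      _   = []
    keys-in-E (t ∷ F) ⊆E = inj₁ (⊆E (here ≡.refl)) ∷ keys-in-E F (λ t∈ → ⊆E (there t∈))

  below-top : ∀ j {e} → e ℤ.< top → + j ℤ.< top ℤ.+ + j ℤ.- e
  below-top j {e} e<top = ≡.subst₂ ℤ._<_ (ℤ.+-identityʳ (+ j)) (≡.sym (+-shift top (+ j) e))
                            (ℤ.+-monoʳ-< (+ j) (≡.subst (ℤ._< top ℤ.- e) (ℤ.+-inverseʳ e) (ℤ.+-monoˡ-< (ℤ.- e) e<top)))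

  -- once Q vanishes above j, the coefficient of q^(top + j) in D·Q is d top · Q j
  step : ∀ j → (∀ x → + j ℤ.< x → Q x ≡ + 0) → Q (+ j) ≡ + 0
  step j Q-above with ℤ.i*j≡0⇒i≡0∨j≡0 (d top) leading≡0
    where
    open ≡.≡-Reasoning
    others : ∀ e → e ∈ E → e ≢ top → d e ℤ.* Q (top ℤ.+ + j ℤ.- e) ≡ + 0
    others e e∈E e≢top with ℤ.<-cmp e top
    ... | tri< e<top _ _ = ≡.trans (≡.cong (d e ℤ.*_) (Q-above _ (below-top j e<top))) (ℤ.*-zeroʳ (d e))
    ... | tri≈ _ e≡top _ = ⊥-elim (e≢top e≡top)
    ... | tri> _ _ top<e = ≡.cong (ℤ._* Q (top ℤ.+ + j ℤ.- e)) (above-top e e∈E top<e)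
    leading≡0 : d top ℤ.* Q (+ j) ≡ + 0
    leading≡0 = begin
      d top ℤ.* Q (+ j)
        ≡⟨ ≡.cong (λ x → d top ℤ.* Q x) (+-shift-cancel top (+ j)) ⟩
      d top ℤ.* Q (top ℤ.+ + j ℤ.- top)
        ≡⟨ ℤ[q±].sumOver-single E _ top (Dedup.deduplicate-! _) (proj₁ top-nonzero) others ⟨
      ℤ[q±].sumOver E (λ e → d e ℤ.* Q (top ℤ.+ + j ℤ.- e))
        ≡⟨ DQ≡sum (top ℤ.+ + j) ⟨
      ℤ[q±].eval (λ e → Q (top ℤ.+ + j ℤ.- e)) D
        ≡⟨ DQ≡0 (top ℤ.+ + j) ⟩
      + 0 ∎
  ... | inj₁ d[top]≡0 = ⊥-elim (proj₂ top-nonzero d[top]≡0)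
  ... | inj₂ Q[j]≡0   = Q[j]≡0

  Q-above-by : ∀ t j → B ℕ.< j ℕ.+ t → Q (+ j) ≡ + 0
  Q-above-by zero    j B<j   = Q-large j (≡.subst (B ℕ.<_) (ℕ.+-identityʳ j) B<j)
  Q-above-by (suc t) j B<j+t = step j above
    where
    above : ∀ x → + j ℤ.< x → Q x ≡ + 0
    above -[1+ n ] ()
    above (+ k) (+<+ j<k) = Q-above-by t k (ℕ.<-≤-trans B<j+t (≡.subst (ℕ._≤ k ℕ.+ t) (≡.sym (ℕ.+-suc j t)) (ℕ.+-monoˡ-≤ t j<k)))

  Q≡0 : ∀ x → Q x ≡ + 0
  Q≡0 -[1+ n ] = Q-neg n
  Q≡0 (+ j)    = Q-above-by (suc B) j (ℕ.<-≤-trans (ℕ.n<1+n B) (ℕ.m≤n+m (suc B) j))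

module ℤ⟨q,u⟩ = FormalSums ℤ.+-*-commutativeRing (Product.≡-dec ℤ._≟_ _≟W_)

coefficient≡coeffL : ∀ F n w → ℤ⟨q,u⟩.coefficient F (n , w) ≡ coeffL F n w
coefficient≡coeffL []                n w = ≡.refl
coefficient≡coeffL ((c , e , v) ∷ F) n w with e ℤ.≟ n
coefficient≡coeffL ((c , e , v) ∷ F) n w | yes ≡.refl with v ≟W w
... | yes ≡.refl rewrite coefficient≡coeffL F n w = ≡.refl
... | no _       rewrite coefficient≡coeffL F n w = ≡.refl
coefficient≡coeffL ((c , e , v) ∷ F) n w | no _       with v ≟W w
... | yes _ rewrite coefficient≡coeffL F n w = ≡.refl
... | no _  rewrite coefficient≡coeffL F n w = ≡.refl

open ℤ⟨q,u⟩ using () renaming (eval to evalq)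

evalq-⊗ˡ : ∀ ψ c e l g → evalq ψ ([ (c , e , l) ] ⊗L g) ≡ c ℤ.* evalq (λ k → ψ (e ℤ.+ proj₁ k , l ++ proj₂ k)) g
evalq-⊗ˡ ψ c e l []                = ≡.sym (ℤ.*-zeroʳ c)
evalq-⊗ˡ ψ c e l ((d , e′ , u) ∷ g) = begin
  c ℤ.* d ℤ.* ψ (e ℤ.+ e′ , l ++ u) ℤ.+ evalq ψ ([ (c , e , l) ] ⊗L g)
    ≡⟨ ≡.cong₂ ℤ._+_ (ℤ.*-assoc c d _) (evalq-⊗ˡ ψ c e l g) ⟩
  c ℤ.* (d ℤ.* ψ (e ℤ.+ e′ , l ++ u)) ℤ.+ c ℤ.* evalq (λ k → ψ (e ℤ.+ proj₁ k , l ++ proj₂ k)) g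
    ≡⟨ ℤ.*-distribˡ-+ c _ _ ⟨
  c ℤ.* evalq (λ k → ψ (e ℤ.+ proj₁ k , l ++ proj₂ k)) ((d , e′ , u) ∷ g) ∎
  where open ≡.≡-Reasoning

evalq-⊗ʳ : ∀ ψ h r → evalq ψ (h ⊗L [ (+ 1 , + 0 , r) ]) ≡ evalq (λ k → ψ (proj₁ k , proj₂ k ++ r)) h
evalq-⊗ʳ ψ []                r = ≡.refl
evalq-⊗ʳ ψ ((c , e , v) ∷ h) r =
  ≡.cong₂ ℤ._+_ (≡.cong₂ (λ x y → x ℤ.* ψ (y , v ++ r)) (ℤ.*-identityʳ c) (ℤ.+-identityʳ e)) (evalq-⊗ʳ ψ h r)

evalq-translate : ∀ ψ c e l g r →
  evalq ψ (([ (c , e , l) ] ⊗L g) ⊗L [ (+ 1 , + 0 , r) ]) ≡ c ℤ.* evalq (λ k → ψ (e ℤ.+ proj₁ k , l ++ proj₂ k ++ r)) g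
evalq-translate ψ c e l g r = begin
  evalq ψ (([ (c , e , l) ] ⊗L g) ⊗L [ (+ 1 , + 0 , r) ])
    ≡⟨ evalq-⊗ʳ ψ ([ (c , e , l) ] ⊗L g) r ⟩
  evalq (λ k → ψ (proj₁ k , proj₂ k ++ r)) ([ (c , e , l) ] ⊗L g)
    ≡⟨ evalq-⊗ˡ _ c e l g ⟩
  c ℤ.* evalq (λ k → ψ (e ℤ.+ proj₁ k , (l ++ proj₂ k) ++ r)) g
    ≡⟨ ≡.cong (c ℤ.*_) (ℤ⟨q,u⟩.eval-cong g (λ k → ≡.cong (λ w → ψ (e ℤ.+ proj₁ k , w)) (List.++-assoc l (proj₂ k) r))) ⟩
  c ℤ.* evalq (λ k → ψ (e ℤ.+ proj₁ k , l ++ proj₂ k ++ r)) g ∎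
  where open ≡.≡-Reasoning

gradedIndicator : Maybe Letter → ℤ → ℤ × Word → ℤ
gradedIndicator e N k = lamIndicator e (N ℤ.- proj₁ k) (proj₂ k)

gradedSupport : ℤ → List (ℤ × Word)
gradedSupport N = map (λ w → (N ℤ.- + qInversions w , w)) words8

gradedSupport-unique : ∀ N → Unique (gradedSupport N)
gradedSupport-unique N = Unique.map⁺ (≡.cong proj₂) words8-unique

gradedIndicator-supported : ∀ e N → ℤ⟨q,u⟩.SupportedOn (gradedSupport N) (gradedIndicator e N)
gradedIndicator-supported e N (d , w) with gradedIndicator e N (d , w) ℤ.≟ + 0
... | yes ψ≡0 = inj₂ ψ≡0
... | no nz    = inj₁ (≡.subst (λ x → (x , w) ∈ gradedSupport N) (d≡ (proj₂ stats))
                        (∈.∈-map⁺ (λ w → (N ℤ.- + qInversions w , w)) (words8-complete w (isPermutation⇒length≡8 w (proj₁ stats)))))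
  where
  stats : isPermutation w ≡ true × N ℤ.- d ≡ + qInversions w
  stats = lamIndicator-nonzero e (N ℤ.- d) w nz
  d≡ : N ℤ.- d ≡ + qInversions w → N ℤ.- + qInversions w ≡ d
  d≡ eq = ≡.trans (≡.cong (λ x → N ℤ.- x) (≡.sym eq)) (double-negation N d)
    where
    double-negation : ∀ N d → N ℤ.- (N ℤ.- d) ≡ d
    double-negation = solve-∀

evalq-scaleL : ∀ e N (D : LaurentZ) f →
  evalq (gradedIndicator e N) (scaleL D f) ≡ ℤ[q±].eval (λ d → eval (lamIndicator e (N ℤ.- d)) f) D
evalq-scaleL e N []            f = ≡.refl
evalq-scaleL e N ((c , d) ∷ D) f = begin
  evalq ψ (scaled f ++ scaleL D f)                          ≡⟨ ℤ⟨q,u⟩.eval-++ ψ (scaled f) (scaleL D f) ⟩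
  evalq ψ (scaled f) ℤ.+ evalq ψ (scaleL D f)               ≡⟨ ≡.cong₂ ℤ._+_ (scaled-eval f) (evalq-scaleL e N D f) ⟩
  c ℤ.* eval (lamIndicator e (N ℤ.- d)) f ℤ.+ ℤ[q±].eval (λ d → eval (lamIndicator e (N ℤ.- d)) f) D ∎
  where
  open ≡.≡-Reasoning
  ψ : ℤ × Word → ℤ
  ψ = gradedIndicator e N
  scaled : ZPoly → LPoly
  scaled = map (λ { (a , w) → (c ℤ.* a , d , w) })
  scaled-eval : ∀ f → evalq ψ (scaled f) ≡ c ℤ.* eval (lamIndicator e (N ℤ.- d)) f
  scaled-eval []            = ≡.sym (ℤ.*-zeroʳ c)
  scaled-eval ((a , w) ∷ f) =
    ≡.trans (≡.cong₂ ℤ._+_ (ℤ.*-assoc c a _) (scaled-eval f)) (≡.sym (ℤ.*-distribˡ-+ c _ _))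

shift-exponent : ∀ N e → N ℤ.- (e ℤ.+ ℤ.- + 1) ≡ N ℤ.- (e ℤ.+ + 0) ℤ.+ + 1
shift-exponent = solve-∀

gradedIndicator-kills : ∀ o N e l g r → lamGen 7 g → evalq (λ k → gradedIndicator o N (e ℤ.+ proj₁ k , l ++ proj₂ k ++ r)) g ≡ + 0
gradedIndicator-kills o N e l g r (inj₁ (a , c , a+7<c , _)) = ⊥-elim (letters-within-7 a c a+7<c)
gradedIndicator-kills o N e l g r (inj₂ (inj₁ (a , b , a<b , b<a+7 , ≡.refl))) =
  ℤ⟨q,u⟩.eval-binomial (λ k → gradedIndicator o N (e ℤ.+ proj₁ k , l ++ proj₂ k ++ r))
    (+ 0 , a ∷ b ∷ []) (ℤ.- + 1 , b ∷ a ∷ [])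
    (≡.sym (≡.trans (≡.cong (λ j → lamIndicator o j (l ++ b ∷ a ∷ r)) (shift-exponent N e))
                    (lamIndicator-QSwap o (N ℤ.- (e ℤ.+ + 0)) (qswap l r a<b b<a+7))))
gradedIndicator-kills o N e l g r (inj₂ (inj₂ (w , w-rep , ≡.refl))) =
  ℤ⟨q,u⟩.eval-monomial (λ k → gradedIndicator o N (e ℤ.+ proj₁ k , l ++ proj₂ k ++ r)) (+ 0 , w)
    (lamIndicator-supported o (N ℤ.- (e ℤ.+ + 0)) (l ++ w ++ r) (isPermutation-infix l w r w-rep))

lamIndicator-vanishes : ∀ e j w → (isPermutation w ≡ true → j ≢ + qInversions w) → lamIndicator e j w ≡ + 0
lamIndicator-vanishes e j w off with lamIndicator e j w ℤ.≟ + 0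
... | yes ≡0 = ≡0
... | no nz  = ⊥-elim (off (proj₁ (lamIndicator-nonzero e j w nz)) (proj₂ (lamIndicator-nonzero e j w nz)))

qInversions≤64 : ∀ w → isPermutation w ≡ true → qInversions w ≤ 64
qInversions≤64 w isPerm = ≡.subst (λ n → qInversions w ≤ n ℕ.* n) (isPermutation⇒length≡8 w isPerm) (qInversions≤length² w)

lamIndicator-kills-Lam : ∀ f → I-Lam 7 f → ∀ e j → eval (lamIndicator e j) f ≡ + 0
lamIndicator-kills-Lam f (D , D≢0 , comb , gens , Df≡comb) e =
  laurent-cancel D D≢0 64 (λ j → eval (lamIndicator e j) f)
    (λ n → ℤ⟨u⟩.eval-zero f (λ w → lamIndicator-vanishes e -[1+ n ] w (λ _ ())))
    (λ j 64<j → ℤ⟨u⟩.eval-zero f (λ w → lamIndicator-vanishes e (+ j) w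
                  (λ isPerm j≡q → ℕ.<⇒≱ 64<j (≡.subst (_≤ 64) (≡.sym (ℤ.+-injective j≡q)) (qInversions≤64 w isPerm)))))
    DQ≡0
  where
  DQ≡0 : ∀ N → ℤ[q±].eval (λ d → eval (lamIndicator e (N ℤ.- d)) f) D ≡ + 0
  DQ≡0 N = begin
    ℤ[q±].eval (λ d → eval (lamIndicator e (N ℤ.- d)) f) D
      ≡⟨ evalq-scaleL e N D f ⟨
    evalq (gradedIndicator e N) (scaleL D f)
      ≡⟨ ℤ⟨q,u⟩.eval-resp-coefficient (gradedSupport-unique N) (gradedIndicator-supported e N)
                                      (scaleL D f) (expandL comb) same-coefficients ⟩
    evalq (gradedIndicator e N) (expandL comb)
      ≡⟨ expand-killed comb gens ⟩
    + 0 ∎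
    where
    open ≡.≡-Reasoning
    same-coefficients : ∀ k → ℤ⟨q,u⟩.coefficient (scaleL D f) k ≡ ℤ⟨q,u⟩.coefficient (expandL comb) k
    same-coefficients (n , w) = ≡.trans (coefficient≡coeffL (scaleL D f) n w)
                                  (≡.trans (Df≡comb n w) (≡.sym (coefficient≡coeffL (expandL comb) n w)))
    expand-killed : ∀ comb → All (λ t → lamGen 7 (genTermL t)) comb → evalq (gradedIndicator e N) (expandL comb) ≡ + 0
    expand-killed []                           []           = ≡.refl
    expand-killed ((c , d , l , g , r) ∷ comb) (gen ∷ gens) = begin
      evalq ψ ((([ (c , d , l) ] ⊗L g) ⊗L [ (+ 1 , + 0 , r) ]) ++ expandL comb)
        ≡⟨ ℤ⟨q,u⟩.eval-++ ψ (([ (c , d , l) ] ⊗L g) ⊗L [ (+ 1 , + 0 , r) ]) (expandL comb) ⟩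
      evalq ψ (([ (c , d , l) ] ⊗L g) ⊗L [ (+ 1 , + 0 , r) ]) ℤ.+ evalq ψ (expandL comb)
        ≡⟨ ≡.cong₂ ℤ._+_ (evalq-translate ψ c d l g r) (expand-killed comb gens) ⟩
      c ℤ.* evalq (λ k → ψ (d ℤ.+ proj₁ k , l ++ proj₂ k ++ r)) g ℤ.+ + 0
        ≡⟨ ≡.cong (λ x → c ℤ.* x ℤ.+ + 0) (gradedIndicator-kills e N d l g r gen) ⟩
      c ℤ.* + 0 ℤ.+ + 0
        ≡⟨ ≡.trans (ℤ.+-identityʳ _) (ℤ.*-zeroʳ c) ⟩
      + 0 ∎
      where
      ψ : ℤ × Word → ℤ
      ψ = gradedIndicator e N

lamWeight : List (Maybe Letter × ℕ) → LamStatistics → ℤ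
lamWeight []            s = + 0
lamWeight ((e , j) ∷ S) s = iverson (lamTest e (+ j) s) ℤ.+ lamWeight S s

lamWeight-natural : ∀ S s → ∃[ n ] lamWeight S s ≡ + n
lamWeight-natural []            s = 0 , ≡.refl
lamWeight-natural ((e , j) ∷ S) s with lamTest e (+ j) s | lamWeight-natural S s
... | true  | n , eq = suc n , ≡.cong (λ x → + 1 ℤ.+ x) eq
... | false | n , eq = n , ≡.trans (ℤ.+-identityˡ _) eq

lamWeight-nonpermutation : ∀ S f q → lamWeight S (false , f , q) ≡ + 0
lamWeight-nonpermutation []            f q = ≡.refl
lamWeight-nonpermutation ((e , j) ∷ S) f q = ≡.trans (ℤ.+-identityˡ _) (lamWeight-nonpermutation S f q)

lamWeight-kills-Lam : ∀ S f → I-Lam 7 f → eval (λ w → lamWeight S (lamStatistics w)) f ≡ + 0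
lamWeight-kills-Lam []            f f∈I = ℤ⟨u⟩.eval-zero f (λ _ → ≡.refl)
lamWeight-kills-Lam ((e , j) ∷ S) f f∈I =
  ≡.trans (ℤ⟨u⟩.eval-+ (lamIndicator e (+ j)) (λ w → lamWeight S (lamStatistics w)) f)
          (≡.cong₂ ℤ._+_ (lamIndicator-kills-Lam f f∈I e (+ j)) (lamWeight-kills-Lam S f f∈I))

-- found by computer, like knuthClass
lamCertificate : List (Maybe Letter × ℕ)
lamCertificate = map (λ j → just u₈ , 13 ℕ.+ j) (upTo 10) ++ map (λ j → just u₁ , 13 ℕ.+ j) (upTo 5)

lamFunctional : Word → ℤ
lamFunctional w = lamWeight lamCertificate (lamStatistics w)

lamFunctional-supported : PermutationSupported lamFunctional
lamFunctional-supported w notPerm =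
  ≡.trans (≡.cong (λ p → lamWeight lamCertificate (p , firstExtreme w , qInversions w)) notPerm)
          (lamWeight-nonpermutation lamCertificate (firstExtreme w) (qInversions w))

lamFunctional-assaf : AssafInvariant lamFunctional
lamFunctional-assaf l r a b c a<b b<c =
  ≡.cong (lamWeight lamCertificate) (bac≈acb a<b b<c l r) , ≡.cong (lamWeight lamCertificate) (bca≈cab a<b b<c l r)

lamFunctional-on-class : All (λ w → lamFunctional w ≡ + 1) knuthClass
lamFunctional-on-class = toWitness {a? = All.all? (λ w → lamFunctional w ℤ.≟ + 1) knuthClass} tt

lamFunctional-dominates : ∀ w → ∃[ n ] lamFunctional w ≡ placticFunctional w ℤ.+ + n
lamFunctional-dominates w with placticFunctional w ℤ.≟ + 0
... | yes P≡0 = let (n , eq) = lamWeight-natural lamCertificate (lamStatistics w) in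
                n , ≡.trans eq (≡.cong (ℤ._+ + n) (≡.sym P≡0))
... | no P≢0  = 0 , ≡.trans (All.lookup lamFunctional-on-class (placticFunctional-nonzero w P≢0))
                            (≡.cong (λ b → iverson b ℤ.+ + 0) (≡.sym (iverson-nonzero _ P≢0)))

lamFunctional-J : eval lamFunctional J2222 ≡ + 11
lamFunctional-J = ≡.refl

placticFunctional-J : eval placticFunctional J2222 ≡ + 12
placticFunctional-J = ≡.refl

-- Real coefficients

module Extension (R : CommutativeRing 0ℓ 0ℓ) where
  open CommutativeRing R
  open IntegerCast R
  open import Algebra.Properties.Ring ring using (-1*x≈-x)
  open import Relation.Binary.Reasoning.Setoid setoid
  module R⟨u⟩ = FormalSums R _≟W_
  open R⟨u⟩ using (sumOver)

  coefficient≡coeffR : ∀ p w → R⟨u⟩.coefficient p w ≡ coeffR R p w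
  coefficient≡coeffR []            w = ≡.refl
  coefficient≡coeffR ((x , v) ∷ p) w rewrite coefficient≡coeffR p w = ≡.refl

  intCast-sumOver : ∀ L g → intCast R (ℤ⟨u⟩.sumOver L g) ≈ sumOver L (λ w → intCast R (g w))
  intCast-sumOver []      g = refl
  intCast-sumOver (w ∷ L) g = trans (intCast-+ (g w) _) (+-congˡ (intCast-sumOver L g))

  module _ {φ : Word → ℤ} (φ-supp : PermutationSupported φ) where
    private
      ψ : Word → Carrier
      ψ w = intCast R (φ w)

    ψ-supp : R⟨u⟩.SupportedOn words8 ψ
    ψ-supp w with PermutationSupported⇒SupportedOn φ-supp w
    ... | inj₁ w∈    = inj₁ w∈
    ... | inj₂ φw≡0 = inj₂ (reflexive (≡.cong (intCast R) φw≡0))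

    pairing-intCast : ∀ g → sumOver words8 (λ w → intCast R (coeff g w) * ψ w) ≈ intCast R (eval φ g)
    pairing-intCast g = begin
      sumOver words8 (λ w → intCast R (coeff g w) * ψ w)
        ≈⟨ R⟨u⟩.sumOver-cong words8 (λ w → sym (intCast-* (coeff g w) (φ w))) ⟩
      sumOver words8 (λ w → intCast R (coeff g w ℤ.* φ w))
        ≈⟨ intCast-sumOver words8 _ ⟨
      intCast R (ℤ⟨u⟩.sumOver words8 (λ w → coeff g w ℤ.* φ w))
        ≡⟨ ≡.cong (intCast R) ℤ-pairing ⟨
      intCast R (eval φ g) ∎
      where
      ℤ-pairing : eval φ g ≡ ℤ⟨u⟩.sumOver words8 (λ w → coeff g w ℤ.* φ w)
      ℤ-pairing = ≡.trans (ℤ⟨u⟩.eval≈sumOver-coefficient words8 φ words8-unique g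
                            (ℤ⟨u⟩.supported-terms (PermutationSupported⇒SupportedOn φ-supp) g))
                          (ℤ⟨u⟩.sumOver-cong words8 (λ w → ≡.cong (ℤ._* φ w) (coefficient≡coeff g w)))

    pairing-span : ∀ {I : ZPoly → Set} → (∀ g → I g → eval φ g ≡ + 0) → ∀ s → All (λ t → I (proj₂ t)) s →
                   sumOver words8 (λ w → spanCoeff R s w * ψ w) ≈ 0#
    pairing-span kills []            []           = R⟨u⟩.sumOver-zero words8 _ (λ w _ → zeroˡ (ψ w))
    pairing-span kills ((x , g) ∷ s) (g∈I ∷ s∈I) = begin
      sumOver words8 (λ w → (x * intCast R (coeff g w) + spanCoeff R s w) * ψ w)
        ≈⟨ R⟨u⟩.sumOver-cong words8 (λ w → trans (distribʳ _ _ _) (+-congʳ (*-assoc _ _ _))) ⟩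
      sumOver words8 (λ w → x * (intCast R (coeff g w) * ψ w) + spanCoeff R s w * ψ w)
        ≈⟨ R⟨u⟩.sumOver-+ words8 _ _ ⟩
      sumOver words8 (λ w → x * (intCast R (coeff g w) * ψ w)) + sumOver words8 (λ w → spanCoeff R s w * ψ w)
        ≈⟨ +-cong (R⟨u⟩.sumOver-*ˡ words8 x _) (pairing-span kills s s∈I) ⟩
      x * sumOver words8 (λ w → intCast R (coeff g w) * ψ w) + 0#
        ≈⟨ +-identityʳ _ ⟩
      x * sumOver words8 (λ w → intCast R (coeff g w) * ψ w)
        ≈⟨ *-congˡ (trans (pairing-intCast g) (reflexive (≡.cong (intCast R) (kills g g∈I)))) ⟩
      x * 0#
        ≈⟨ zeroʳ x ⟩
      0# ∎

    eval-DiffInSpan : ∀ {I : ZPoly → Set} → (∀ g → I g → eval φ g ≡ + 0) → ∀ f p → DiffInSpan R I f p →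
                      R⟨u⟩.eval ψ p ≈ intCast R (eval φ f)
    eval-DiffInSpan kills f p (s , s∈I , f-p≈s) = sym (x∙y⁻¹≈ε⇒x≈y _ _ difference≈0)
      where
      open import Algebra.Properties.AbelianGroup +-abelianGroup using (x∙y⁻¹≈ε⇒x≈y)
      pointwise : ∀ w → intCast R (coeff f w) * ψ w + - 1# * (R⟨u⟩.coefficient p w * ψ w) ≈ spanCoeff R s w * ψ w
      pointwise w = begin
        intCast R (coeff f w) * ψ w + - 1# * (R⟨u⟩.coefficient p w * ψ w)
          ≈⟨ +-congˡ (trans (-1*x≈-x _) (-‿distribˡ-* _ _)) ⟩
        intCast R (coeff f w) * ψ w + - R⟨u⟩.coefficient p w * ψ w
          ≈⟨ distribʳ _ _ _ ⟨
        (intCast R (coeff f w) - R⟨u⟩.coefficient p w) * ψ w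
          ≈⟨ *-congʳ (trans (+-congˡ (-‿cong (reflexive (coefficient≡coeffR p w)))) (f-p≈s w)) ⟩
        spanCoeff R s w * ψ w ∎
        where open import Algebra.Properties.Ring ring using (-‿distribˡ-*)
      difference≈0 : intCast R (eval φ f) - R⟨u⟩.eval ψ p ≈ 0#
      difference≈0 = begin
        intCast R (eval φ f) - R⟨u⟩.eval ψ p
          ≈⟨ +-cong (sym (pairing-intCast f))
                    (-‿cong (R⟨u⟩.eval≈sumOver-coefficient words8 ψ words8-unique p (R⟨u⟩.supported-terms ψ-supp p))) ⟩
        sumOver words8 (λ w → intCast R (coeff f w) * ψ w) - sumOver words8 (λ w → R⟨u⟩.coefficient p w * ψ w)
          ≈⟨ +-congˡ (trans (sym (-1*x≈-x _)) (sym (R⟨u⟩.sumOver-*ˡ words8 (- 1#) _))) ⟩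
        sumOver words8 (λ w → intCast R (coeff f w) * ψ w) + sumOver words8 (λ w → - 1# * (R⟨u⟩.coefficient p w * ψ w))
          ≈⟨ R⟨u⟩.sumOver-+ words8 _ _ ⟨
        sumOver words8 (λ w → intCast R (coeff f w) * ψ w + - 1# * (R⟨u⟩.coefficient p w * ψ w))
          ≈⟨ R⟨u⟩.sumOver-cong words8 pointwise ⟩
        sumOver words8 (λ w → spanCoeff R s w * ψ w)
          ≈⟨ pairing-span kills s s∈I ⟩
        0# ∎

lamFunctional-kills-Lam : ∀ f → I-Lam 7 f → eval lamFunctional f ≡ + 0
lamFunctional-kills-Lam = lamWeight-kills-Lam lamCertificate

lamFunctional-kills-Assaf : ∀ f → I-Assaf 7 f → eval lamFunctional f ≡ + 0
lamFunctional-kills-Assaf = eval-ideal words8-unique (PermutationSupported⇒SupportedOn lamFunctional-supported)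
  (kills-assaf₇ {lamFunctional} lamFunctional-assaf (PermutationSupported⇒VanishesOnRepeats lamFunctional-supported))

placticFunctional-kills-plac : ∀ f → I-plac f → eval placticFunctional f ≡ + 0
placticFunctional-kills-plac = eval-ideal words8-unique (PermutationSupported⇒SupportedOn placticFunctional-supported)
  (kills-plactic {placticFunctional} placticFunctional-knuth (PermutationSupported⇒VanishesOnRepeats placticFunctional-supported))

placticFunctional-kills-Assaf : ∀ f → I-Assaf 1 f → eval placticFunctional f ≡ + 0
placticFunctional-kills-Assaf = eval-ideal words8-unique (PermutationSupported⇒SupportedOn placticFunctional-supported)
  (kills-assaf₁ {placticFunctional} placticFunctional-knuth (PermutationSupported⇒VanishesOnRepeats placticFunctional-supported))

module Separation (R : CommutativeRing 0ℓ 0ℓ) (C : NonnegCone R) where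
  open CommutativeRing R
  open NonnegCone C
  open IntegerCast R
  open Extension R
  open import Algebra.Properties.AbelianGroup +-abelianGroup using (∙-cancelˡ; inverseʳ-unique)

  natCast-nonneg : ∀ n → Nonneg (natCast R n)
  natCast-nonneg zero    = Nonneg-0
  natCast-nonneg (suc n) = Nonneg-+ Nonneg-1 (natCast-nonneg n)

  eval-nonneg : ∀ ψ p → All (λ t → Nonneg (proj₁ t)) p → (∀ w → Nonneg (ψ w)) → Nonneg (R⟨u⟩.eval ψ p)
  eval-nonneg ψ []            []           ψ≥0 = Nonneg-0
  eval-nonneg ψ ((x , w) ∷ p) (x≥0 ∷ p≥0) ψ≥0 = Nonneg-+ (Nonneg-* x≥0 (ψ≥0 w)) (eval-nonneg ψ p p≥0 ψ≥0)

  x≈1+x+y⇒y≈-1 : ∀ x y → x ≈ (1# + x) + y → y ≈ - 1#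
  x≈1+x+y⇒y≈-1 x y x≈ = inverseʳ-unique 1# y (∙-cancelˡ x _ _ (begin
    x + (1# + y) ≈⟨ +-assoc x 1# y ⟨
    x + 1# + y   ≈⟨ +-congʳ (+-comm x 1#) ⟩
    1# + x + y   ≈⟨ x≈ ⟨
    x            ≈⟨ +-identityʳ x ⟨
    x + 0#       ∎))
    where open import Relation.Binary.Reasoning.Setoid setoid

  separation : ∀ {I I′ : ZPoly → Set} →
    (∀ f → I f → eval lamFunctional f ≡ + 0) → (∀ f → I′ f → eval placticFunctional f ≡ + 0) →
    ∀ p → All (λ t → Nonneg (proj₁ t)) p → DiffInSpan R I J2222 p → DiffInSpan R I′ J2222 p → ⊥
  separation lam-kills plac-kills p p≥0 J-p∈I J-p∈I′ =
    Nonneg-neg (Nonneg-≈ gap≈-1 (eval-nonneg (natCast R ∘ gap) p p≥0 (λ w → natCast-nonneg (gap w))))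
    where
    gap : Word → ℕ
    gap w = proj₁ (lamFunctional-dominates w)
    lam-value : R⟨u⟩.eval (intCast R ∘ lamFunctional) p ≈ intCast R (+ 11)
    lam-value = trans (eval-DiffInSpan {lamFunctional} lamFunctional-supported lam-kills J2222 p J-p∈I)
                      (reflexive (≡.cong (intCast R) lamFunctional-J))
    plac-value : R⟨u⟩.eval (intCast R ∘ placticFunctional) p ≈ intCast R (+ 12)
    plac-value = trans (eval-DiffInSpan {placticFunctional} placticFunctional-supported plac-kills J2222 p J-p∈I′)
                       (reflexive (≡.cong (intCast R) placticFunctional-J))
    split : R⟨u⟩.eval (intCast R ∘ lamFunctional) p ≈ R⟨u⟩.eval (intCast R ∘ placticFunctional) p + R⟨u⟩.eval (natCast R ∘ gap) p
    split = trans (R⟨u⟩.eval-cong p (λ w → trans (reflexive (≡.cong (intCast R) (proj₂ (lamFunctional-dominates w))))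
                                                  (intCast-+ (placticFunctional w) (+ gap w))))
                  (R⟨u⟩.eval-+ _ _ p)
    gap≈-1 : R⟨u⟩.eval (natCast R ∘ gap) p ≈ - 1#
    gap≈-1 = x≈1+x+y⇒y≈-1 _ _ (trans (sym lam-value) (trans split (+-congʳ plac-value)))

corollary7p3 : (R : CommutativeRing 0ℓ 0ℓ) (C : NonnegCone R) →
    (¬ Σ (RPoly R) (λ p → All (λ t → NonnegCone.Nonneg C (proj₁ t)) p ×
        ((k : ℕ) → 1 ≤ k → k ≤ 8 → DiffInSpan R (I-Lam k) J2222 p) ×
        DiffInSpan R I-plac J2222 p))
    × (¬ Σ (RPoly R) (λ p → All (λ t → NonnegCone.Nonneg C (proj₁ t)) p ×
        ((k : ℕ) → 1 ≤ k → k ≤ 8 → DiffInSpan R (I-Assaf k) J2222 p)))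
corollary7p3 R C =
  (λ (p , p≥0 , J-p∈Lam , J-p∈plac) →
     separation lamFunctional-kills-Lam placticFunctional-kills-plac p p≥0 (J-p∈Lam 7 (s≤s z≤n) (ℕ.n≤1+n 7)) J-p∈plac) ,
  (λ (p , p≥0 , J-p∈Assaf) →
     separation lamFunctional-kills-Assaf placticFunctional-kills-Assaf p p≥0
       (J-p∈Assaf 7 (s≤s z≤n) (ℕ.n≤1+n 7)) (J-p∈Assaf 1 (s≤s z≤n) (s≤s z≤n)))
  where open Separation R C
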